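{- Let $M=M[U,L]$ be a connected lattice path matroid of rank $r$ on $r+m$ elements, with $\mathrm{st}(L)=(L_1,\dots,L_{r+m})$ and $\mathrm{st}(U)=(U_1,\dots,U_{r+m})$. Then there exists a bijective affine transformation taking $P_M\subset\mathbb{R}^{r+m}$ onto a full-dimensional distributive integer polytope $Q_M\subset\mathbb{R}^{r+m-1}$, where $Q_M$ consists of all $q\in\mathbb{R}^{r+m-1}$ such that $$0\leq (-1)^{L_{i+1}}(q_{i+1}-q_i)\leq 1 \quad\text{for all } i\in\{1,\dots,r+m-2\}$$ and $$0\leq q_i\leq \sum_{j=1}^i(U_j-L_j)\quad\text{for all } i\in\{1,\dots,r+m-1\}.$$ Moreover, $L_{P_M}(t)=L_{Q_M}(t)$.
   Context: A lattice path from $(0,0)$ to $(m,r)$ uses unit steps $(1,0)$ and $(0,1)$; its step vector $\mathrm{st}(P)\in\{0,1\}^{r+m}$ lists the $y$-changes of its steps. For lattice paths $U,L$ from $(0,0)$ to $(m,r)$ with $L$ never above $U$, $M[U,L]$ is the matroid on $\{1,\dots,r+m\}$ whose bases are the sets $\{i:P_i=1\}$ for lattice paths $P$ never above $U$ and never below $L$; it is connected iff $U$ and $L$ meet only at $(0,0)$ and $(m,r)$. $P_M=\mathrm{conv}\{\sum_{i\in B}e_i:B\text{ a basis}\}$. A polytope $Q\subseteq\mathbb{R}^n$ is distributive if for all $x,y\in Q$ the componentwise maximum and minimum of $x,y$ lie in $Q$. For a polytope $P\subseteq\mathbb{R}^n$, $L_P(t)=\#(tP\cap\mathbb{Z}^n)$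 for integers $t\ge0$.
   Formalization: The polytopes $P_M$ and $Q_M$ are taken as sets of points in ℚ^(r+m) and ℚ^(r+m−1) rather than ℝ^(r+m) and ℝ^(r+m−1), and the affine transformation has rational coefficients. -}

module Defs where

open import Data.Bool using (Bool; true; false; if_then_else_)
open import Data.Nat as ℕ using (ℕ; zero; suc; _∸_)
import Data.Fin
open Data.Fin using (Fin; toℕ)
open import Data.Integer as ℤ using (ℤ; +_)
open import Data.Rational using (ℚ; 0ℚ; 1ℚ; _+_; _*_; _-_; -_; _≤_; _<_; _⊔_; _⊓_; ∣_∣; _/_)
open import Data.List using (List; []; _∷_)
open import Data.List.Relation.Unary.All using (All)
open import Data.Product using (Σ; ∃; _×_; _,_)
open import Relation.Binary.PropositionalEquality using (_≡_)
open import Data.Maybe using (Maybe; just; nothing)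
import Data.List.Membership.Propositional

ℤ→ℚ : ℤ → ℚ
ℤ→ℚ z = z / 1

ℕ→ℚ : ℕ → ℚ
ℕ→ℚ n = (+ n) / 1

lookupℕ : {A : Set} {n : ℕ} → (Fin n → A) → ℕ → Maybe A
lookupℕ {n = zero}  v k       = nothing
lookupℕ {n = suc n} v zero    = just (v Data.Fin.zero)
lookupℕ {n = suc n} v (suc k) = lookupℕ (λ i → v (Data.Fin.suc i)) k

getℕ : {A : Set} {n : ℕ} → A → (Fin n → A) → ℕ → A
getℕ d v k with lookupℕ v k
... | just a  = a
... | nothing = d

-- A lattice path from (0,0) to (m,r) is encoded by its step vector
-- st(P) ∈ {0,1}^{r+m}, here a function Fin (r+m) → Bool
-- (true = 1 = north step (0,1), false = 0 = east step (1,0)).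
StepVec : ℕ → Set
StepVec n = Fin n → Bool

b2n : Bool → ℕ
b2n true  = 1
b2n false = 0

-- height(P, k) = number of north steps among the first k steps
-- (= y-coordinate of the path after k steps)
height : {n : ℕ} → StepVec n → ℕ → ℕ
height P zero    = 0
height P (suc k) = height P k ℕ.+ b2n (getℕ false P k)

-- P is a lattice path from (0,0) to (m,r)  (with n = r + m steps):
-- it has exactly r north steps
IsPath : (r m : ℕ) → StepVec (r ℕ.+ m) → Set
IsPath r m P = height P (r ℕ.+ m) ≡ r

-- P never above Q: after each number k of steps, P is not higher than Q
-- (paths with the same number of steps are at the same x+y level)
NeverAbove : {n : ℕ} → StepVec n → StepVec n → Set
NeverAbove {n} P Q = ∀ k → k ℕ.≤ n → height P k ℕ.≤ height Q k

-- U and L meet only at (0,0) and (m,r):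
-- at every intermediate step count 0 < k < n they are at different points
MeetOnlyAtEnds : {n : ℕ} → StepVec n → StepVec n → Set
MeetOnlyAtEnds {n} U L = ∀ k → 0 ℕ.< k → k ℕ.< n → height L k ℕ.< height U k

-- Bases of M[U,L]: (supports of) lattice paths P from (0,0) to (m,r)
-- never above U and never below L.  A basis {i : P_i = 1} is identified
-- with its indicator vector, which is exactly st(P).
IsBasisPath : (r m : ℕ) → (U L : StepVec (r ℕ.+ m)) → StepVec (r ℕ.+ m) → Set
IsBasisPath r m U L P = IsPath r m P × NeverAbove P U × NeverAbove L P

Pt : ℕ → Set
Pt n = Fin n → ℚ

_≐_ : {n : ℕ} → Pt n → Pt n → Set
x ≐ y = ∀ i → x i ≡ y i

indicator : {n : ℕ} → StepVec n → Pt n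
indicator P i = if P i then 1ℚ else 0ℚ

weightSum : {n : ℕ} → List (ℚ × Pt n) → ℚ
weightSum []             = 0ℚ
weightSum ((w , _) ∷ ws) = w + weightSum ws

combo : {n : ℕ} → List (ℚ × Pt n) → Pt n
combo []             i = 0ℚ
combo ((w , p) ∷ ws) i = w * p i + combo ws i

InConvHull : {n : ℕ} → (Pt n → Set) → Pt n → Set
InConvHull {n} S x =
  Σ (List (ℚ × Pt n)) λ ws →
    All (λ wp → 0ℚ ≤ Data.Product.proj₁ wp × S (Data.Product.proj₂ wp)) ws
    × weightSum ws ≡ 1ℚ
    × x ≐ combo ws

P-M : (r m : ℕ) → (U L : StepVec (r ℕ.+ m)) → Pt (r ℕ.+ m) → Set
P-M r m U L = InConvHull (λ x → Σ (StepVec (r ℕ.+ m)) λ P →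
                                  IsBasisPath r m U L P × x ≐ indicator P)

-- The polytope Q_M ⊆ ℚ^{r+m-1}
-- (0-based indexing: paper index i corresponds to Fin index i-1)

signed : Bool → ℚ → ℚ
signed true  d = - d
signed false d = d

Q-M : (r m : ℕ) → (U L : StepVec (r ℕ.+ m)) → Pt ((r ℕ.+ m) ∸ 1) → Set
Q-M r m U L q =
  -- paper: 0 ≤ (-1)^{L_{i+1}} (q_{i+1} - q_i) ≤ 1 for 1 ≤ i ≤ r+m-2;
  -- here j = i - 1 (0-based), L_{i+1} is 0-based entry j+1 of L
  (∀ j → suc j ℕ.< (r ℕ.+ m) ∸ 1 →
     let d = signed (getℕ false L (suc j)) (getℕ 0ℚ q (suc j) - getℕ 0ℚ q j)
     in 0ℚ ≤ d × d ≤ 1ℚ)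
  ×
  -- paper: 0 ≤ q_i ≤ Σ_{j=1}^{i} (U_j - L_j) for 1 ≤ i ≤ r+m-1;
  -- that sum equals height U i - height L i
  (∀ (j : Fin ((r ℕ.+ m) ∸ 1)) →
     0ℚ ≤ q j ×
     q j ≤ ℕ→ℚ (height U (suc (toℕ j))) - ℕ→ℚ (height L (suc (toℕ j))))

record AffineMap (n d : ℕ) : Set where
  constructor affine
  field
    mat : Fin d → Fin n → ℚ
    off : Fin d → ℚ

dot : {n : ℕ} → (Fin n → ℚ) → (Fin n → ℚ) → ℚ
dot {zero}  a x = 0ℚ
dot {suc n} a x = a Data.Fin.zero * x Data.Fin.zero
                  + dot (λ i → a (Data.Fin.suc i)) (λ i → x (Data.Fin.suc i))

apply : {n d : ℕ} → AffineMap n d → Pt n → Pt d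
apply f x k = dot (AffineMap.mat f k) x + AffineMap.off f k

BijectsOnto : {n d : ℕ} → AffineMap n d → (Pt n → Set) → (Pt d → Set) → Set
BijectsOnto {n} {d} f P Q =
  (∀ x → P x → Q (apply f x))
  × (∀ x y → P x → P y → apply f x ≐ apply f y → x ≐ y)
  × (∀ q → Q q → Σ (Pt n) λ x → P x × apply f x ≐ q)

Distributive : {n : ℕ} → (Pt n → Set) → Set
Distributive {n} Q = ∀ x y → Q x → Q y →
  Q (λ i → x i ⊔ y i) × Q (λ i → x i ⊓ y i)

FullDimensional : {n : ℕ} → (Pt n → Set) → Set
FullDimensional {n} Q = Σ (Pt n) λ c → Σ ℚ λ ε → 0ℚ < ε ×
  (∀ x → (∀ i → ∣ x i - c i ∣ ≤ ε) → Q x)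

IntegerPolytope : {n : ℕ} → (Pt n → Set) → Set
IntegerPolytope {n} Q = Σ (List (Fin n → ℤ)) λ vs →
  ∀ x → (Q x → InConvHull (λ p → Σ (Fin n → ℤ) λ z →
                              Data.List.Membership.Propositional._∈_ z vs
                              × p ≐ (λ i → ℤ→ℚ (z i))) x)
        × (InConvHull (λ p → Σ (Fin n → ℤ) λ z →
                              Data.List.Membership.Propositional._∈_ z vs
                              × p ≐ (λ i → ℤ→ℚ (z i))) x → Q x)

-- membership of an integer point z ∈ ℤ^n in the dilate tP:
-- z = t·x for some x ∈ P   (t = 0 gives tP = {0} for nonempty P)
InDilate : {n : ℕ} → (Pt n → Set) → ℕ → (Fin n → ℤ) → Set
InDilate {n} P t z = Σ (Pt n) λ x → P x × (∀ i → ℤ→ℚ (z i) ≡ ℕ→ℚ t * x i)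

SameCard : {n d : ℕ} → ((Fin n → ℤ) → Set) → ((Fin d → ℤ) → Set) → Set
SameCard {n} {d} A B = Σ ((Fin n → ℤ) → (Fin d → ℤ)) λ g →
  (∀ z → A z → B (g z))
  × (∀ z w → A z → A w → (∀ k → g z k ≡ g w k) → ∀ i → z i ≡ w i)
  × (∀ y → B y → Σ (Fin n → ℤ) λ z → A z × (∀ k → g z k ≡ y k))

SameEhrhart : {n d : ℕ} → (Pt n → Set) → (Pt d → Set) → ℕ → Set
SameEhrhart P Q t = SameCard (InDilate P t) (InDilate Q t)

module Submission where

-- Write n = r + m, h_P(k) for the height of a path P after k steps, and
-- d = n - 1.  The affine map  f(x)_j = x_0 + ... + x_j - h_L(j+1)  sends the
-- indicator vector of a lattice path P to its height profile h_P - h_L.  On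
-- the hyperplane  x_0 + ... + x_{n-1} = r  it is inverted by the discrete
-- derivative  g(q)_i = q_i - q_{i-1} + L_i  (with q_{-1} = q_{n-1} = 0).
--
-- Hence f is
-- a bijection P_M → Q_M with inverse g, Q_M is an integer polytope, and as f
-- and g have integer coefficients they also match the lattice points of the
-- dilates.  Distributivity comes from the stability of unit steps, and full
-- dimension from an explicit interior box (this is where U and L meeting
-- only at the ends is used).

open import Defs

module Proof where
  open import Data.Bool using (Bool; true; false; if_then_else_)
  open import Data.Nat as ℕ using (ℕ; zero; suc; z≤n; s≤s)
  import Data.Nat.Properties as ℕₚ
  open import Data.Nat.Coprimality using (Coprime)
  open import Data.Nat.Divisibility using (∣1⇒≡1)
  open import Data.Nat.Tactic.RingSolver as ℕ-Solver using ()
  open import Data.Fin using (Fin; toℕ; fromℕ<)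
  import Data.Fin as Fin
  import Data.Fin.Properties as Finₚ
  open import Data.Integer as ℤ using (ℤ; -[1+_])
  import Data.Integer.Properties as ℤₚ
  open import Data.Rational as ℚ
    using (ℚ; mkℚ; 0ℚ; 1ℚ; toℚᵘ; _+_; _*_; _-_; -_; _≤_; _<_; _⊔_; _⊓_; ∣_∣)
  import Data.Rational.Properties as ℚₚ
  import Data.Rational.Unnormalised as ℚᵘ
  import Data.Rational.Unnormalised.Properties as ℚᵘₚ
  open import Data.Maybe using (Maybe; just; nothing; fromMaybe)
  open import Data.Product using (Σ; _×_; _,_; proj₁; proj₂; map₂; uncurry)
  open import Data.Sum using (inj₁; inj₂)
  open import Data.List using (List; []; _∷_; map; filter; allFin; upTo; cartesianProductWith)
  open import Data.List.Sort ℚₚ.≤-decTotalOrder using (sort; sort-↭; sort-↗)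
  open import Data.List.Relation.Unary.Sorted.TotalOrder.Properties using (Sorted⇒AllPairs)
  open import Data.List.Relation.Binary.Permutation.Propositional using (↭-sym)
  open import Data.List.Relation.Binary.Permutation.Propositional.Properties using (All-resp-↭; Any-resp-↭)
  open import Data.List.Relation.Unary.All using (All; []; _∷_)
  import Data.List.Relation.Unary.All as All
  import Data.List.Relation.Unary.All.Properties as Allₚ
  open import Data.List.Relation.Unary.Any using (here; there)
  open import Data.List.Relation.Unary.AllPairs using (AllPairs; []; _∷_)
  open import Data.List.Membership.Propositional using (_∈_)
  open import Data.List.Membership.Propositional.Properties
    using (∈-map⁺; ∈-map⁻; ∈-filter⁺; ∈-filter⁻; ∈-allFin; ∈-upTo⁺;
           ∈-cartesianProductWith⁺; ∈-cartesianProductWith⁻)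
  open import Relation.Nullary using (¬_; Dec; yes; no)
  open import Relation.Nullary.Decidable using (does; dec-true; dec-false; _×-dec_; _→-dec_; map′)
  open import Relation.Binary.PropositionalEquality
  open import Relation.Binary.Bundles using (DecTotalOrder)
  open import Tactic.RingSolver using (solve-∀)
  open import Level using (0ℓ)
  open import Tactic.RingSolver.Core.AlmostCommutativeRing
    using (AlmostCommutativeRing; fromCommutativeRing)

  ℚ-ring : AlmostCommutativeRing 0ℓ 0ℓ
  ℚ-ring = fromCommutativeRing ℚₚ.+-*-commutativeRing zero?
    where
    zero? : ∀ x → Maybe (0ℚ ≡ x)
    zero? x with 0ℚ ℚₚ.≟ x
    ... | yes p = just p
    ... | no _  = nothing

  -- z / 1 is already in normal form, so ℤ→ℚ z is the fraction mkℚ z 0.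
  coprime-1 : ∀ n → Coprime n 1
  coprime-1 n (_ , i∣1) = ∣1⇒≡1 i∣1

  ℤ→ℚ≡mkℚ : ∀ z → ℤ→ℚ z ≡ mkℚ z 0 (coprime-1 ℤ.∣ z ∣)
  ℤ→ℚ≡mkℚ (ℤ.+ n)  = ℚₚ.normalize-coprime (coprime-1 n)
  ℤ→ℚ≡mkℚ -[1+ n ] = cong -_ (ℚₚ.normalize-coprime (coprime-1 (suc n)))

  toℚᵘ-ℤ→ℚ : ∀ z → toℚᵘ (ℤ→ℚ z) ≡ ℚᵘ.mkℚᵘ z 0
  toℚᵘ-ℤ→ℚ z rewrite ℤ→ℚ≡mkℚ z = refl

  ℤ→ℚ-from-ℚᵘ : ∀ z p → ℚᵘ.mkℚᵘ z 0 ℚᵘ.≃ toℚᵘ p → ℤ→ℚ z ≡ p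
  ℤ→ℚ-from-ℚᵘ z p e =
    ℚₚ.toℚᵘ-injective (ℚᵘₚ.≃-trans (ℚᵘₚ.≃-reflexive (toℚᵘ-ℤ→ℚ z)) e)

  ℤ→ℚ-+ : ∀ a b → ℤ→ℚ (a ℤ.+ b) ≡ ℤ→ℚ a + ℤ→ℚ b
  ℤ→ℚ-+ a b = ℤ→ℚ-from-ℚᵘ (a ℤ.+ b) _ (ℚᵘₚ.≃-trans sum (ℚᵘₚ.≃-sym
    (ℚᵘₚ.≃-trans (ℚₚ.toℚᵘ-homo-+ (ℤ→ℚ a) (ℤ→ℚ b))
                 (ℚᵘₚ.≃-reflexive (cong₂ ℚᵘ._+_ (toℚᵘ-ℤ→ℚ a) (toℚᵘ-ℤ→ℚ b))))))
    where
    sum : ℚᵘ.mkℚᵘ (a ℤ.+ b) 0 ℚᵘ.≃ (ℚᵘ.mkℚᵘ a 0 ℚᵘ.+ ℚᵘ.mkℚᵘ b 0)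
    sum = ℚᵘ.*≡* (cong₂ (λ x y → (x ℤ.+ y) ℤ.* ℤ.1ℤ)
                        (sym (ℤₚ.*-identityʳ a)) (sym (ℤₚ.*-identityʳ b)))

  ℤ→ℚ-* : ∀ a b → ℤ→ℚ (a ℤ.* b) ≡ ℤ→ℚ a * ℤ→ℚ b
  ℤ→ℚ-* a b = ℤ→ℚ-from-ℚᵘ (a ℤ.* b) _ (ℚᵘₚ.≃-sym
    (ℚᵘₚ.≃-trans (ℚₚ.toℚᵘ-homo-* (ℤ→ℚ a) (ℤ→ℚ b))
                 (ℚᵘₚ.≃-reflexive (cong₂ ℚᵘ._*_ (toℚᵘ-ℤ→ℚ a) (toℚᵘ-ℤ→ℚ b)))))

  ℤ→ℚ-neg : ∀ a → ℤ→ℚ (ℤ.- a) ≡ - ℤ→ℚ a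
  ℤ→ℚ-neg a = ℤ→ℚ-from-ℚᵘ (ℤ.- a) _ (ℚᵘₚ.≃-sym
    (ℚᵘₚ.≃-trans (ℚₚ.toℚᵘ-homo‿- (ℤ→ℚ a))
                 (ℚᵘₚ.≃-reflexive (cong ℚᵘ.-_ (toℚᵘ-ℤ→ℚ a)))))

  ℤ→ℚ-- : ∀ a b → ℤ→ℚ (a ℤ.- b) ≡ ℤ→ℚ a - ℤ→ℚ b
  ℤ→ℚ-- a b = trans (ℤ→ℚ-+ a (ℤ.- b)) (cong (λ v → ℤ→ℚ a + v) (ℤ→ℚ-neg b))

  -- Order is reflected and preserved, since the denominators are 1.
  ℤ→ℚ-mono-≤ : ∀ {a b} → a ℤ.≤ b → ℤ→ℚ a ≤ ℤ→ℚ b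
  ℤ→ℚ-mono-≤ {a} {b} p rewrite ℤ→ℚ≡mkℚ a | ℤ→ℚ≡mkℚ b =
    ℚ.*≤* (subst₂ ℤ._≤_ (sym (ℤₚ.*-identityʳ a)) (sym (ℤₚ.*-identityʳ b)) p)

  ℤ→ℚ-cancel-≤ : ∀ {a b} → ℤ→ℚ a ≤ ℤ→ℚ b → a ℤ.≤ b
  ℤ→ℚ-cancel-≤ {a} {b} p rewrite ℤ→ℚ≡mkℚ a | ℤ→ℚ≡mkℚ b with p
  ... | ℚ.*≤* q = subst₂ ℤ._≤_ (ℤₚ.*-identityʳ a) (ℤₚ.*-identityʳ b) q

  ℤ→ℚ-injective : ∀ {a b} → ℤ→ℚ a ≡ ℤ→ℚ b → a ≡ b
  ℤ→ℚ-injective e = ℤₚ.≤-antisym (ℤ→ℚ-cancel-≤ (ℚₚ.≤-reflexive e))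
                                  (ℤ→ℚ-cancel-≤ (ℚₚ.≤-reflexive (sym e)))

  ℕ→ℚ-+ : ∀ a b → ℕ→ℚ (a ℕ.+ b) ≡ ℕ→ℚ a + ℕ→ℚ b
  ℕ→ℚ-+ a b = ℤ→ℚ-+ (ℤ.+ a) (ℤ.+ b)

  ℕ→ℚ-* : ∀ a b → ℕ→ℚ (a ℕ.* b) ≡ ℕ→ℚ a * ℕ→ℚ b
  ℕ→ℚ-* a b = trans (cong ℤ→ℚ (ℤₚ.pos-* a b)) (ℤ→ℚ-* (ℤ.+ a) (ℤ.+ b))

  ℕ→ℚ-suc : ∀ a → ℕ→ℚ (suc a) ≡ ℕ→ℚ a + 1ℚ
  ℕ→ℚ-suc a = trans (cong ℕ→ℚ (ℕₚ.+-comm 1 a)) (ℕ→ℚ-+ a 1)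

  ℕ→ℚ-∸ : ∀ a b → b ℕ.≤ a → ℕ→ℚ (a ℕ.∸ b) ≡ ℕ→ℚ a - ℕ→ℚ b
  ℕ→ℚ-∸ a b b≤a = begin
    ℕ→ℚ (a ℕ.∸ b)                       ≡⟨ add-sub (ℕ→ℚ (a ℕ.∸ b)) (ℕ→ℚ b) ⟩
    ℕ→ℚ (a ℕ.∸ b) + ℕ→ℚ b - ℕ→ℚ b       ≡⟨ cong (_- ℕ→ℚ b) (sym (ℕ→ℚ-+ (a ℕ.∸ b) b)) ⟩
    ℕ→ℚ (a ℕ.∸ b ℕ.+ b) - ℕ→ℚ b         ≡⟨ cong (λ c → ℕ→ℚ c - ℕ→ℚ b) (ℕₚ.m∸n+n≡m b≤a) ⟩
    ℕ→ℚ a - ℕ→ℚ b                        ∎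
    where
    open ≡-Reasoning
    add-sub : ∀ x y → x ≡ x + y - y
    add-sub = solve-∀ ℚ-ring

  ℕ→ℚ-mono-≤ : ∀ {a b} → a ℕ.≤ b → ℕ→ℚ a ≤ ℕ→ℚ b
  ℕ→ℚ-mono-≤ p = ℤ→ℚ-mono-≤ (ℤ.+≤+ p)

  ℕ→ℚ-cancel-≤ : ∀ {a b} → ℕ→ℚ a ≤ ℕ→ℚ b → a ℕ.≤ b
  ℕ→ℚ-cancel-≤ {a} {b} p with ℤ→ℚ-cancel-≤ {ℤ.+ a} {ℤ.+ b} p
  ... | ℤ.+≤+ q = q

  ℕ→ℚ-nonneg : ∀ a → 0ℚ ≤ ℕ→ℚ a
  ℕ→ℚ-nonneg a = ℕ→ℚ-mono-≤ {0} {a} z≤n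

  0≤1 : 0ℚ ≤ 1ℚ
  0≤1 = ℚₚ.≤ᵇ⇒≤ _

  neg-neg : ∀ p → - (- p) ≡ p
  neg-neg = solve-∀ ℚ-ring

  ≤⇒0≤- : ∀ {a b} → a ≤ b → 0ℚ ≤ b - a
  ≤⇒0≤- {a} p = ℚₚ.≤-trans (ℚₚ.≤-reflexive (sym (ℚₚ.+-inverseʳ a))) (ℚₚ.+-monoˡ-≤ (- a) p)

  0≤-⇒≤ : ∀ {a b} → 0ℚ ≤ b - a → a ≤ b
  0≤-⇒≤ {a} {b} p = begin
    a            ≡⟨ sym (ℚₚ.+-identityʳ a) ⟩
    a + 0ℚ       ≤⟨ ℚₚ.+-monoʳ-≤ a p ⟩
    a + (b - a)  ≡⟨ cancel a b ⟩
    b            ∎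
    where
    open ℚₚ.≤-Reasoning
    cancel : ∀ a b → a + (b - a) ≡ b
    cancel = solve-∀ ℚ-ring

  -≤⇒≤+ : ∀ {a b c} → b - a ≤ c → b ≤ a + c
  -≤⇒≤+ {a} {b} p = ℚₚ.≤-trans (ℚₚ.≤-reflexive (cancel a b)) (ℚₚ.+-monoʳ-≤ a p)
    where
    cancel : ∀ a b → b ≡ a + (b - a)
    cancel = solve-∀ ℚ-ring

  ≤-⇒+≤ : ∀ {a b c} → c ≤ b - a → c + a ≤ b
  ≤-⇒+≤ {a} {b} p = ℚₚ.≤-trans (ℚₚ.+-monoˡ-≤ a p) (ℚₚ.≤-reflexive (cancel a b))
    where
    cancel : ∀ a b → b - a + a ≡ b
    cancel = solve-∀ ℚ-ring

  p≤∣p∣ : ∀ p → p ≤ ∣ p ∣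
  p≤∣p∣ p with ℚₚ.∣p∣≡p∨∣p∣≡-p p
  ... | inj₁ e = ℚₚ.≤-reflexive (sym e)
  ... | inj₂ e = ℚₚ.≤-trans p≤0 (ℚₚ.0≤∣p∣ p)
    where
    p≤0 : p ≤ 0ℚ
    p≤0 = subst (_≤ 0ℚ) (neg-neg p)
            (ℚₚ.neg-antimono-≤ (subst (0ℚ ≤_) e (ℚₚ.0≤∣p∣ p)))

  ∣-∣≤⇒box : ∀ x c w → ∣ x - c ∣ ≤ w → c - w ≤ x × x ≤ c + w
  ∣-∣≤⇒box x c w p =
    ℚₚ.≤-trans (ℚₚ.+-monoʳ-≤ c -w≤t) (ℚₚ.≤-reflexive (c+[x-c] c x)) ,
    ℚₚ.≤-trans (ℚₚ.≤-reflexive (sym (c+[x-c] c x))) (ℚₚ.+-monoʳ-≤ c t≤w)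
    where
    t≤w : x - c ≤ w
    t≤w = ℚₚ.≤-trans (p≤∣p∣ (x - c)) p
    -w≤t : - w ≤ x - c
    -w≤t = subst (- w ≤_) (neg-neg (x - c)) (ℚₚ.neg-antimono-≤
             (ℚₚ.≤-trans (p≤∣p∣ (- (x - c))) (subst (_≤ w) (sym (ℚₚ.∣-p∣≡∣p∣ (x - c))) p)))
    c+[x-c] : ∀ c x → c + (x - c) ≡ x
    c+[x-c] = solve-∀ ℚ-ring

  -- Total indexing: at d v k is the k-th entry of v, or d when k is out of
  -- range.  It is a structurally recursive form of Defs.getℕ.

  at : {A : Set} {n : ℕ} → A → (Fin n → A) → ℕ → A
  at {n = zero}  d v k       = d
  at {n = suc n} d v zero    = v Fin.zero
  at {n = suc n} d v (suc k) = at d (λ i → v (Fin.suc i)) k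

  fromMaybe-lookupℕ : ∀ {A : Set} {n} (d : A) (v : Fin n → A) k →
                      fromMaybe d (lookupℕ v k) ≡ at d v k
  fromMaybe-lookupℕ {n = zero}  d v k       = refl
  fromMaybe-lookupℕ {n = suc n} d v zero    = refl
  fromMaybe-lookupℕ {n = suc n} d v (suc k) = fromMaybe-lookupℕ d (λ i → v (Fin.suc i)) k

  getℕ≡at : ∀ {A : Set} {n} (d : A) (v : Fin n → A) k → getℕ d v k ≡ at d v k
  getℕ≡at d v k = trans getℕ≡fromMaybe (fromMaybe-lookupℕ d v k)
    where
    getℕ≡fromMaybe : getℕ d v k ≡ fromMaybe d (lookupℕ v k)
    getℕ≡fromMaybe with lookupℕ v k
    ... | just a  = refl
    ... | nothing = refl

  at-fromℕ< : ∀ {A : Set} {n} (d : A) (v : Fin n → A) k (k<n : k ℕ.< n) →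
              at d v k ≡ v (fromℕ< k<n)
  at-fromℕ< {n = suc n} d v zero    k<n       = refl
  at-fromℕ< {n = suc n} d v (suc k) (s≤s k<n) = at-fromℕ< d (λ i → v (Fin.suc i)) k k<n

  at-out : ∀ {A : Set} {n} (d : A) (v : Fin n → A) k → n ℕ.≤ k → at d v k ≡ d
  at-out {n = zero}  d v k       n≤k       = refl
  at-out {n = suc n} d v (suc k) (s≤s n≤k) = at-out d (λ i → v (Fin.suc i)) k n≤k

  at-toℕ : ∀ {A : Set} {n} (d : A) (v : Fin n → A) (i : Fin n) → at d v (toℕ i) ≡ v i
  at-toℕ d v Fin.zero    = refl
  at-toℕ d v (Fin.suc i) = at-toℕ d (λ j → v (Fin.suc j)) i

  at-map : ∀ {A B : Set} {n} (g : A → B) (d : A) (v : Fin n → A) k →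
           at (g d) (λ i → g (v i)) k ≡ g (at d v k)
  at-map {n = zero}  g d v k       = refl
  at-map {n = suc n} g d v zero    = refl
  at-map {n = suc n} g d v (suc k) = at-map g d (λ i → v (Fin.suc i)) k

  at-tabulate : ∀ {A : Set} {n} (d : A) (f : ℕ → A) k → k ℕ.< n →
                at {n = n} d (λ i → f (toℕ i)) k ≡ f k
  at-tabulate {n = suc n} d f zero    k<n       = refl
  at-tabulate {n = suc n} d f (suc k) (s≤s k<n) = at-tabulate d (λ j → f (suc j)) k k<n

  at-cong : ∀ {A : Set} {n} (d : A) {v w : Fin n → A} → (∀ i → v i ≡ w i) → ∀ k →
            at d v k ≡ at d w k
  at-cong {n = zero}  d e k       = refl
  at-cong {n = suc n} d e zero    = e Fin.zero
  at-cong {n = suc n} d e (suc k) = at-cong d (λ i → e (Fin.suc i)) k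

  at-map-in : ∀ {A B : Set} {n} (g : A → B) (d : A) (d' : B) (v : Fin n → A) k → k ℕ.< n →
              at d' (λ i → g (v i)) k ≡ g (at d v k)
  at-map-in g d d' v k k<n = trans (at-fromℕ< d' _ k k<n) (cong g (sym (at-fromℕ< d v k k<n)))

  at-map₂ : ∀ {A : Set} {n} (g : A → A → A) (d : A) (v w : Fin n → A) k → k ℕ.< n →
            at d (λ i → g (v i) (w i)) k ≡ g (at d v k) (at d w k)
  at-map₂ g d v w k k<n =
    trans (at-fromℕ< d _ k k<n) (sym (cong₂ g (at-fromℕ< d v k k<n) (at-fromℕ< d w k k<n)))

  at-map-default : ∀ {A : Set} {n} (g : A → A) (d : A) → g d ≡ d → (v : Fin n → A) → ∀ k →
                   at d (λ i → g (v i)) k ≡ g (at d v k)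
  at-map-default g d gd≡d v k = trans (cong (λ e → at e (λ i → g (v i)) k) (sym gd≡d)) (at-map g d v k)

  Σ< : (ℕ → ℚ) → ℕ → ℚ
  Σ< a zero    = 0ℚ
  Σ< a (suc k) = Σ< a k + a k

  Σ<-cong : ∀ (a b : ℕ → ℚ) c → (∀ k → k ℕ.< c → a k ≡ b k) → Σ< a c ≡ Σ< b c
  Σ<-cong a b zero    e = refl
  Σ<-cong a b (suc c) e =
    cong₂ _+_ (Σ<-cong a b c (λ k k<c → e k (ℕₚ.m<n⇒m<1+n k<c))) (e c ℕₚ.≤-refl)

  Σ<-front : ∀ (a : ℕ → ℚ) c → Σ< a (suc c) ≡ a 0 + Σ< (λ k → a (suc k)) c
  Σ<-front a zero    = trans (ℚₚ.+-identityˡ (a 0)) (sym (ℚₚ.+-identityʳ (a 0)))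
  Σ<-front a (suc c) = trans (cong (_+ a (suc c)) (Σ<-front a c)) (ℚₚ.+-assoc (a 0) _ _)

  Σ<ℤ : (ℕ → ℤ) → ℕ → ℤ
  Σ<ℤ a zero    = ℤ.+ 0
  Σ<ℤ a (suc k) = Σ<ℤ a k ℤ.+ a k

  ℤ→ℚ-Σ<ℤ : ∀ a c → ℤ→ℚ (Σ<ℤ a c) ≡ Σ< (λ k → ℤ→ℚ (a k)) c
  ℤ→ℚ-Σ<ℤ a zero    = refl
  ℤ→ℚ-Σ<ℤ a (suc c) = trans (ℤ→ℚ-+ (Σ<ℤ a c) (a c)) (cong (_+ ℤ→ℚ (a c)) (ℤ→ℚ-Σ<ℤ a c))

  Σ<-scale : ∀ c (a : ℕ → ℚ) K → Σ< (λ k → c * a k) K ≡ c * Σ< a K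
  Σ<-scale c a zero    = sym (ℚₚ.*-zeroʳ c)
  Σ<-scale c a (suc K) =
    trans (cong (_+ c * a K) (Σ<-scale c a K)) (sym (ℚₚ.*-distribˡ-+ c (Σ< a K) (a K)))

  prefixRow : ∀ {m} → ℕ → Pt m
  prefixRow c i = if toℕ i ℕ.<ᵇ c then 1ℚ else 0ℚ

  dot-zero : ∀ {m} (x : Pt m) → dot (λ _ → 0ℚ) x ≡ 0ℚ
  dot-zero {zero}  x = refl
  dot-zero {suc m} x = trans (cong (λ s → 0ℚ * x Fin.zero + s) (dot-zero (λ i → x (Fin.suc i))))
                             (trans (ℚₚ.+-identityʳ _) (ℚₚ.*-zeroˡ (x Fin.zero)))

  dot-prefixRow : ∀ {m} c (x : Pt m) → c ℕ.≤ m → dot (prefixRow c) x ≡ Σ< (at 0ℚ x) c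
  dot-prefixRow {zero}  zero    x c≤m       = refl
  dot-prefixRow {suc m} zero    x c≤m       = dot-zero x
  dot-prefixRow {suc m} (suc c) x (s≤s c≤m) =
    trans (cong₂ _+_ (ℚₚ.*-identityˡ (x Fin.zero)) (dot-prefixRow c (λ i → x (Fin.suc i)) c≤m))
          (sym (Σ<-front (at 0ℚ x) c))

  wsum : {A : Set} → List (ℚ × A) → (A → ℚ) → ℚ
  wsum []             φ = 0ℚ
  wsum ((w , p) ∷ ws) φ = w * φ p + wsum ws φ

  combo-wsum : ∀ {m} (ws : List (ℚ × Pt m)) i → combo ws i ≡ wsum ws (λ p → p i)
  combo-wsum []             i = refl
  combo-wsum ((w , p) ∷ ws) i = cong (λ s → w * p i + s) (combo-wsum ws i)

  wsum-congᴬ : ∀ {A : Set} (ws : List (ℚ × A)) {φ ψ : A → ℚ} →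
               All (λ wp → φ (proj₂ wp) ≡ ψ (proj₂ wp)) ws → wsum ws φ ≡ wsum ws ψ
  wsum-congᴬ []             []       = refl
  wsum-congᴬ ((w , p) ∷ ws) (e ∷ es) = cong₂ (λ a s → w * a + s) e (wsum-congᴬ ws es)

  wsum-cong : ∀ {A : Set} (ws : List (ℚ × A)) {φ ψ : A → ℚ} →
              (∀ p → φ p ≡ ψ p) → wsum ws φ ≡ wsum ws ψ
  wsum-cong ws e = wsum-congᴬ ws (All.universal (λ wp → e (proj₂ wp)) ws)

  wsum-+ : ∀ {A : Set} (ws : List (ℚ × A)) (φ ψ : A → ℚ) →
           wsum ws φ + wsum ws ψ ≡ wsum ws (λ p → φ p + ψ p)
  wsum-+ []             φ ψ = ℚₚ.+-identityˡ 0ℚ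
  wsum-+ ((w , p) ∷ ws) φ ψ =
    trans (distrib w (φ p) (ψ p) (wsum ws φ) (wsum ws ψ))
          (cong (λ s → w * (φ p + ψ p) + s) (wsum-+ ws φ ψ))
    where
    distrib : ∀ w a b s t → (w * a + s) + (w * b + t) ≡ w * (a + b) + (s + t)
    distrib = solve-∀ ℚ-ring

  wsum-neg : ∀ {A : Set} (ws : List (ℚ × A)) (φ : A → ℚ) →
             - wsum ws φ ≡ wsum ws (λ p → - φ p)
  wsum-neg []             φ = refl
  wsum-neg ((w , p) ∷ ws) φ =
    trans (distrib w (φ p) (wsum ws φ)) (cong (λ s → w * (- φ p) + s) (wsum-neg ws φ))
    where
    distrib : ∀ w a s → - (w * a + s) ≡ w * (- a) + (- s)
    distrib = solve-∀ ℚ-ring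

  wsum-const : ∀ {m} (ws : List (ℚ × Pt m)) c → wsum ws (λ _ → c) ≡ c * weightSum ws
  wsum-const []             c = sym (ℚₚ.*-zeroʳ c)
  wsum-const ((w , p) ∷ ws) c =
    trans (cong (λ s → w * c + s) (wsum-const ws c)) (distrib w c (weightSum ws))
    where
    distrib : ∀ w c s → w * c + c * s ≡ c * (w + s)
    distrib = solve-∀ ℚ-ring

  wsum-const₁ : ∀ {m} (ws : List (ℚ × Pt m)) c → weightSum ws ≡ 1ℚ → wsum ws (λ _ → c) ≡ c
  wsum-const₁ ws c e = trans (wsum-const ws c) (trans (cong (c *_) e) (ℚₚ.*-identityʳ c))

  wsum-map₂ : ∀ {A B : Set} (g : A → B) (ws : List (ℚ × A)) (φ : B → ℚ) →
              wsum (map (map₂ g) ws) φ ≡ wsum ws (λ p → φ (g p))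
  wsum-map₂ g []             φ = refl
  wsum-map₂ g ((w , p) ∷ ws) φ = cong (λ s → w * φ (g p) + s) (wsum-map₂ g ws φ)

  weightSum-map₂ : ∀ {A : Set} {b} (g : A → Pt b) (ws : List (ℚ × A)) →
                   weightSum (map (map₂ g) ws) ≡ wsum ws (λ _ → 1ℚ)
  weightSum-map₂ g []             = refl
  weightSum-map₂ g ((w , p) ∷ ws) =
    cong₂ _+_ (sym (ℚₚ.*-identityʳ w)) (weightSum-map₂ g ws)

  weightSum≡wsum : ∀ {m} (ws : List (ℚ × Pt m)) → weightSum ws ≡ wsum ws (λ _ → 1ℚ)
  weightSum≡wsum []             = refl
  weightSum≡wsum ((w , p) ∷ ws) = cong₂ _+_ (sym (ℚₚ.*-identityʳ w)) (weightSum≡wsum ws)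

  wsum-lower : ∀ {m} (ws : List (ℚ × Pt m)) (φ : Pt m → ℚ) lo →
               All (λ wp → 0ℚ ≤ proj₁ wp × lo ≤ φ (proj₂ wp)) ws →
               lo * weightSum ws ≤ wsum ws φ
  wsum-lower []             φ lo []                = ℚₚ.≤-reflexive (ℚₚ.*-zeroʳ lo)
  wsum-lower ((w , p) ∷ ws) φ lo ((w≥0 , l) ∷ hs) =
    ℚₚ.≤-trans (ℚₚ.≤-reflexive (distrib lo w (weightSum ws)))
      (ℚₚ.+-mono-≤ (ℚₚ.*-monoˡ-≤-nonNeg w {{ℚ.nonNegative w≥0}} l) (wsum-lower ws φ lo hs))
    where
    distrib : ∀ lo w s → lo * (w + s) ≡ w * lo + lo * s
    distrib = solve-∀ ℚ-ring

  wsum-upper : ∀ {m} (ws : List (ℚ × Pt m)) (φ : Pt m → ℚ) hi →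
               All (λ wp → 0ℚ ≤ proj₁ wp × φ (proj₂ wp) ≤ hi) ws →
               wsum ws φ ≤ hi * weightSum ws
  wsum-upper []             φ hi []                = ℚₚ.≤-reflexive (sym (ℚₚ.*-zeroʳ hi))
  wsum-upper ((w , p) ∷ ws) φ hi ((w≥0 , u) ∷ hs) =
    ℚₚ.≤-trans (ℚₚ.+-mono-≤ (ℚₚ.*-monoˡ-≤-nonNeg w {{ℚ.nonNegative w≥0}} u) (wsum-upper ws φ hi hs))
      (ℚₚ.≤-reflexive (distrib hi w (weightSum ws)))
    where
    distrib : ∀ hi w s → w * hi + hi * s ≡ hi * (w + s)
    distrib = solve-∀ ℚ-ring

  wsum-bounds : ∀ {m} (ws : List (ℚ × Pt m)) (φ : Pt m → ℚ) lo hi → weightSum ws ≡ 1ℚ →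
                All (λ wp → 0ℚ ≤ proj₁ wp × lo ≤ φ (proj₂ wp) × φ (proj₂ wp) ≤ hi) ws →
                lo ≤ wsum ws φ × wsum ws φ ≤ hi
  wsum-bounds ws φ lo hi e hs =
    subst (_≤ wsum ws φ) (scaled lo) (wsum-lower ws φ lo (All.map (λ (w≥0 , l , _) → w≥0 , l) hs)) ,
    subst (wsum ws φ ≤_) (scaled hi) (wsum-upper ws φ hi (All.map (λ (w≥0 , _ , u) → w≥0 , u) hs))
    where
    scaled : ∀ c → c * weightSum ws ≡ c
    scaled c = trans (cong (c *_) e) (ℚₚ.*-identityʳ c)

  Affine : ∀ {m} → (Pt m → ℚ) → Set
  Affine {m} φ = (∀ {x y : Pt m} → x ≐ y → φ x ≡ φ y)
               × (∀ ws → weightSum ws ≡ 1ℚ → φ (combo ws) ≡ wsum ws φ)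

  affine-≗ : ∀ {m} {φ ψ : Pt m → ℚ} → (∀ x → φ x ≡ ψ x) → Affine ψ → Affine φ
  affine-≗ e (ext , lin) =
    (λ {x} {y} x≐y → trans (e x) (trans (ext x≐y) (sym (e y)))) ,
    (λ ws w → trans (e (combo ws)) (trans (lin ws w) (wsum-cong ws (λ p → sym (e p)))))

  affine-coord : ∀ {m} (i : Fin m) → Affine (λ x → x i)
  affine-coord i = (λ x≐y → x≐y i) , (λ ws _ → combo-wsum ws i)

  affine-const : ∀ {m} c → Affine {m} (λ _ → c)
  affine-const c = (λ _ → refl) , (λ ws w → sym (wsum-const₁ ws c w))

  affine-at : ∀ {m} k → Affine {m} (λ x → at 0ℚ x k)
  affine-at {m} k with k ℕ.<? m
  ... | yes k<m = affine-≗ (λ x → at-fromℕ< 0ℚ x k k<m) (affine-coord (fromℕ< k<m))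
  ... | no  k≮m = affine-≗ (λ x → at-out 0ℚ x k (ℕₚ.≮⇒≥ k≮m)) (affine-const 0ℚ)

  affine-+ : ∀ {m} {φ ψ : Pt m → ℚ} → Affine φ → Affine ψ → Affine (λ x → φ x + ψ x)
  affine-+ {φ = φ} {ψ} (extφ , linφ) (extψ , linψ) =
    (λ x≐y → cong₂ _+_ (extφ x≐y) (extψ x≐y)) ,
    (λ ws w → trans (cong₂ _+_ (linφ ws w) (linψ ws w)) (wsum-+ ws φ ψ))

  affine-neg : ∀ {m} {φ : Pt m → ℚ} → Affine φ → Affine (λ x → - φ x)
  affine-neg {φ = φ} (ext , lin) =
    (λ x≐y → cong -_ (ext x≐y)) , (λ ws w → trans (cong -_ (lin ws w)) (wsum-neg ws φ))

  affine-- : ∀ {m} {φ ψ : Pt m → ℚ} → Affine φ → Affine ψ → Affine (λ x → φ x - ψ x)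
  affine-- aφ aψ = affine-+ aφ (affine-neg aψ)

  affine-signed : ∀ {m} σ {φ : Pt m → ℚ} → Affine φ → Affine (λ x → signed σ (φ x))
  affine-signed true  aφ = affine-neg aφ
  affine-signed false aφ = aφ

  affine-Σ< : ∀ {m} (φ : ℕ → Pt m → ℚ) → (∀ k → Affine (φ k)) → ∀ c →
              Affine (λ x → Σ< (λ k → φ k x) c)
  affine-Σ< φ aφ zero    = affine-const 0ℚ
  affine-Σ< φ aφ (suc c) = affine-+ (affine-Σ< φ aφ c) (aφ c)

  hull-bounds : ∀ {m} {S : Pt m → Set} {φ : Pt m → ℚ} lo hi → Affine φ →
                (∀ p → S p → lo ≤ φ p × φ p ≤ hi) →
                ∀ x → InConvHull S x → lo ≤ φ x × φ x ≤ hi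
  hull-bounds {φ = φ} lo hi (ext , lin) bound x (ws , hs , w , x≐) =
    subst (λ v → lo ≤ v × v ≤ hi) (sym (trans (ext x≐) (lin ws w)))
      (wsum-bounds ws φ lo hi w (All.map (λ (w≥0 , s) → w≥0 , bound _ s) hs))

  hull-mono : ∀ {m} {S T : Pt m → Set} → (∀ p → S p → T p) → ∀ x → InConvHull S x → InConvHull T x
  hull-mono S⊆T x (ws , hs , w , x≐) = ws , All.map (λ (w≥0 , s) → w≥0 , S⊆T _ s) hs , w , x≐

  hull-image : ∀ {a b} {S : Pt a → Set} {T : Pt b → Set} (F : Pt a → Pt b) →
               (∀ j → Affine (λ x → F x j)) → (∀ p → S p → T (F p)) →
               ∀ x → InConvHull S x → InConvHull T (F x)
  hull-image F aF S→T x (ws , hs , w , x≐) =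
    map (map₂ F) ws ,
    Allₚ.map⁺ (All.map (λ (w≥0 , s) → w≥0 , S→T _ s) hs) ,
    trans (weightSum-map₂ F ws) (trans (sym (weightSum≡wsum ws)) w) ,
    λ j → begin
      F x j                                   ≡⟨ proj₁ (aF j) x≐ ⟩
      F (combo ws) j                          ≡⟨ proj₂ (aF j) ws w ⟩
      wsum ws (λ p → F p j)                   ≡⟨ sym (wsum-map₂ F ws (λ p → p j)) ⟩
      wsum (map (map₂ F) ws) (λ p → p j)      ≡⟨ sym (combo-wsum (map (map₂ F) ws) j) ⟩
      combo (map (map₂ F) ws) j               ∎
    where open ≡-Reasoning

  bit : Bool → ℚ
  bit b = if b then 1ℚ else 0ℚ

  bit≡ : ∀ b → bit b ≡ ℕ→ℚ (b2n b)
  bit≡ true  = refl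
  bit≡ false = refl

  b2n≤1 : ∀ b → b2n b ℕ.≤ 1
  b2n≤1 true  = s≤s z≤n
  b2n≤1 false = z≤n

  ltBit : ℚ → ℚ → Bool
  ltBit a b = does (a ℚₚ.<? b)

  ltBit-true : ∀ {a b} → a < b → ltBit a b ≡ true
  ltBit-true {a} {b} = dec-true (a ℚₚ.<? b)

  ltBit-false : ∀ {a b} → ¬ a < b → ltBit a b ≡ false
  ltBit-false {a} {b} = dec-false (a ℚₚ.<? b)

  ltBit-cong : ∀ {a b c e} → (a < b → c < e) → (c < e → a < b) → ltBit a b ≡ ltBit c e
  ltBit-cong {a} {b} {c} {e} to from = by-cases (a ℚₚ.<? b)
    where
    by-cases : Dec (a < b) → ltBit a b ≡ ltBit c e
    by-cases (yes a<b) = trans (ltBit-true a<b) (sym (ltBit-true (to a<b)))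
    by-cases (no  a≮b) = trans (ltBit-false a≮b) (sym (ltBit-false (λ c<e → a≮b (from c<e))))

  -- The unit-step relation  0 ≤ (-1)^σ (b - a) ≤ 1:  every difference
  -- constraint of Q_M has this shape.

  UnitStep : Bool → ℚ → ℚ → Set
  UnitStep σ a b = 0ℚ ≤ signed σ (b - a) × signed σ (b - a) ≤ 1ℚ

  unitStep-intro : ∀ {a b} → a ≤ b → b ≤ a + 1ℚ → UnitStep false a b
  unitStep-intro {a} a≤b b≤a+1 =
    ≤⇒0≤- a≤b , ℚₚ.≤-trans (ℚₚ.+-monoˡ-≤ (- a) b≤a+1) (ℚₚ.≤-reflexive (a+1-a a))
    where
    a+1-a : ∀ a → a + 1ℚ - a ≡ 1ℚ
    a+1-a = solve-∀ ℚ-ring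

  unitStep-elim : ∀ a b → UnitStep false a b → a ≤ b × b ≤ a + 1ℚ
  unitStep-elim a b (lo , hi) = 0≤-⇒≤ lo , -≤⇒≤+ hi

  unitStep-flip : ∀ a b → UnitStep true a b → UnitStep false b a
  unitStep-flip a b = subst (λ v → 0ℚ ≤ v × v ≤ 1ℚ) (neg-sub a b)
    where
    neg-sub : ∀ a b → - (b - a) ≡ a - b
    neg-sub = solve-∀ ℚ-ring

  unitStep-unflip : ∀ a b → UnitStep false b a → UnitStep true a b
  unitStep-unflip a b = subst (λ v → 0ℚ ≤ v × v ≤ 1ℚ) (sub-neg a b)
    where
    sub-neg : ∀ a b → a - b ≡ - (b - a)
    sub-neg = solve-∀ ℚ-ring

  unitStep-ℕ⁻ : ∀ a b → UnitStep false (ℕ→ℚ a) (ℕ→ℚ b) → a ℕ.≤ b × b ℕ.≤ suc a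
  unitStep-ℕ⁻ a b s =
    ℕ→ℚ-cancel-≤ (proj₁ (unitStep-elim (ℕ→ℚ a) (ℕ→ℚ b) s)) ,
    ℕ→ℚ-cancel-≤ (ℚₚ.≤-trans (proj₂ (unitStep-elim (ℕ→ℚ a) (ℕ→ℚ b) s))
                             (ℚₚ.≤-reflexive (sym (ℕ→ℚ-suc a))))

  unitStep-ℕ⁺ : ∀ a b → a ℕ.≤ b → b ℕ.≤ suc a → UnitStep false (ℕ→ℚ a) (ℕ→ℚ b)
  unitStep-ℕ⁺ a b a≤b b≤1+a =
    unitStep-intro (ℕ→ℚ-mono-≤ a≤b) (ℚₚ.≤-trans (ℕ→ℚ-mono-≤ b≤1+a) (ℚₚ.≤-reflexive (ℕ→ℚ-suc a)))

  unitStep-bits : ∀ p l → UnitStep l (bit l) (bit p)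
  unitStep-bits true  true  = ℚₚ.≤ᵇ⇒≤ _ , ℚₚ.≤ᵇ⇒≤ _
  unitStep-bits true  false = ℚₚ.≤ᵇ⇒≤ _ , ℚₚ.≤ᵇ⇒≤ _
  unitStep-bits false true  = ℚₚ.≤ᵇ⇒≤ _ , ℚₚ.≤ᵇ⇒≤ _
  unitStep-bits false false = ℚₚ.≤ᵇ⇒≤ _ , ℚₚ.≤ᵇ⇒≤ _

  -- Unit steps are stable under componentwise max and min, since both are
  -- monotone and commute with adding 1.
  ascending-⊔ : ∀ a b a' b' → UnitStep false a b → UnitStep false a' b' →
                UnitStep false (a ⊔ a') (b ⊔ b')
  ascending-⊔ a b a' b' s s' = unitStep-intro
    (ℚₚ.⊔-mono-≤ (proj₁ (unitStep-elim a b s)) (proj₁ (unitStep-elim a' b' s')))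
    (ℚₚ.≤-trans (ℚₚ.⊔-mono-≤ (proj₂ (unitStep-elim a b s)) (proj₂ (unitStep-elim a' b' s')))
                (ℚₚ.≤-reflexive (sym (ℚₚ.mono-≤-distrib-⊔ (ℚₚ.+-monoˡ-≤ 1ℚ) a a'))))

  ascending-⊓ : ∀ a b a' b' → UnitStep false a b → UnitStep false a' b' →
                UnitStep false (a ⊓ a') (b ⊓ b')
  ascending-⊓ a b a' b' s s' = unitStep-intro
    (ℚₚ.⊓-mono-≤ (proj₁ (unitStep-elim a b s)) (proj₁ (unitStep-elim a' b' s')))
    (ℚₚ.≤-trans (ℚₚ.⊓-mono-≤ (proj₂ (unitStep-elim a b s)) (proj₂ (unitStep-elim a' b' s')))
                (ℚₚ.≤-reflexive (sym (ℚₚ.mono-≤-distrib-⊓ (ℚₚ.+-monoˡ-≤ 1ℚ) a a'))))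

  unitStep-⊔ : ∀ σ a b a' b' → UnitStep σ a b → UnitStep σ a' b' → UnitStep σ (a ⊔ a') (b ⊔ b')
  unitStep-⊔ false = ascending-⊔
  unitStep-⊔ true a b a' b' s s' = unitStep-unflip (a ⊔ a') (b ⊔ b')
    (ascending-⊔ b a b' a' (unitStep-flip a b s) (unitStep-flip a' b' s'))

  unitStep-⊓ : ∀ σ a b a' b' → UnitStep σ a b → UnitStep σ a' b' → UnitStep σ (a ⊓ a') (b ⊓ b')
  unitStep-⊓ false = ascending-⊓
  unitStep-⊓ true a b a' b' s s' = unitStep-unflip (a ⊓ a') (b ⊓ b')
    (ascending-⊓ b a b' a' (unitStep-flip a b s) (unitStep-flip a' b' s'))

  unitStep-near : ∀ x x' c c' w → c - w ≤ x → x ≤ c + w → c' - w ≤ x' → x' ≤ c' + w →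
                  w + w ≤ c' - c → c' - c ≤ 1ℚ - (w + w) → UnitStep false x x'
  unitStep-near x x' c c' w x≥ x≤ x'≥ x'≤ gap≥ gap≤ =
    ℚₚ.≤-trans (≤⇒0≤- gap≥)
      (ℚₚ.≤-trans (ℚₚ.≤-reflexive (regroup₁ c c' w)) (ℚₚ.+-mono-≤ x'≥ (ℚₚ.neg-antimono-≤ x≤))) ,
    ℚₚ.≤-trans (ℚₚ.+-mono-≤ x'≤ (ℚₚ.neg-antimono-≤ x≥))
      (ℚₚ.≤-trans (ℚₚ.≤-reflexive (regroup₂ c c' w))
        (ℚₚ.≤-trans (ℚₚ.+-monoˡ-≤ (w + w) gap≤) (ℚₚ.≤-reflexive (regroup₃ w))))
    where
    regroup₁ : ∀ c c' w → c' - c - (w + w) ≡ (c' - w) - (c + w)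
    regroup₁ = solve-∀ ℚ-ring
    regroup₂ : ∀ c c' w → (c' + w) - (c - w) ≡ c' - c + (w + w)
    regroup₂ = solve-∀ ℚ-ring
    regroup₃ : ∀ w → 1ℚ - (w + w) + (w + w) ≡ 1ℚ
    regroup₃ = solve-∀ ℚ-ring

  -- Threshold rounding:  count θ x K = #{k < K : k + θ < x}.  For θ ∈ [0,1)
  -- this rounds x ∈ [0,K] to an integer; it is monotone and 1-Lipschitz in
  -- x, hence preserves unit steps.

  count : ℚ → ℚ → ℕ → ℕ
  count θ x zero    = 0
  count θ x (suc K) = count θ x K ℕ.+ b2n (ltBit (ℕ→ℚ K + θ) x)

  count-mono : ∀ θ {x y} K → x ≤ y → count θ x K ℕ.≤ count θ y K
  count-mono θ zero    x≤y = z≤n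
  count-mono θ (suc K) x≤y = ℕₚ.+-mono-≤ (count-mono θ K x≤y) (bit-mono (ℕ→ℚ K + θ) x≤y)
    where
    bit-mono : ∀ a {x y} → x ≤ y → b2n (ltBit a x) ℕ.≤ b2n (ltBit a y)
    bit-mono a {x} {y} x≤y = by-cases (a ℚₚ.<? x)
      where
      by-cases : Dec (a < x) → b2n (ltBit a x) ℕ.≤ b2n (ltBit a y)
      by-cases (yes a<x) rewrite ltBit-true a<x | ltBit-true (ℚₚ.<-≤-trans a<x x≤y) = ℕₚ.≤-refl
      by-cases (no  a≮x) rewrite ltBit-false a≮x = z≤n

  count-shift : ∀ θ x K → count θ (x + 1ℚ) (suc K) ≡ b2n (ltBit (ℕ→ℚ 0 + θ) (x + 1ℚ)) ℕ.+ count θ x K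
  count-shift θ x zero    = ℕₚ.+-comm 0 _
  count-shift θ x (suc K) =
    trans (cong₂ ℕ._+_ (count-shift θ x K) (cong b2n shifted))
          (ℕₚ.+-assoc (b2n (ltBit (ℕ→ℚ 0 + θ) (x + 1ℚ))) (count θ x K) _)
    where
    regroup : ∀ k t → k + 1ℚ + t ≡ k + t + 1ℚ
    regroup = solve-∀ ℚ-ring
    cancel : ∀ a → a + 1ℚ - 1ℚ ≡ a
    cancel = solve-∀ ℚ-ring
    shifted : ltBit (ℕ→ℚ (suc K) + θ) (x + 1ℚ) ≡ ltBit (ℕ→ℚ K + θ) x
    shifted = trans (cong (λ z → ltBit z (x + 1ℚ)) (trans (cong (_+ θ) (ℕ→ℚ-suc K)) (regroup (ℕ→ℚ K) θ)))
      (ltBit-cong (λ p → subst₂ _<_ (cancel (ℕ→ℚ K + θ)) (cancel x) (ℚₚ.+-monoˡ-< (- 1ℚ) p))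
                  (ℚₚ.+-monoˡ-< 1ℚ))

  count-lipschitz : ∀ θ x K → count θ (x + 1ℚ) K ℕ.≤ suc (count θ x K)
  count-lipschitz θ x zero    = z≤n
  count-lipschitz θ x (suc K) rewrite count-shift θ x K =
    ℕₚ.+-mono-≤ (b2n≤1 _) (ℕₚ.m≤m+n (count θ x K) _)

  -- For θ ≥ 0 and x ≤ c only thresholds k < c lie below x, so the count is
  -- at most c.
  count-bound : ∀ θ x c K → 0ℚ ≤ θ → x ≤ ℕ→ℚ c → count θ x K ℕ.≤ c
  count-bound θ x c zero    θ≥0 x≤c = z≤n
  count-bound θ x c (suc K) θ≥0 x≤c = by-cases (ℕ→ℚ K + θ ℚₚ.<? x)
    where
    count≤K : ∀ θ x K → count θ x K ℕ.≤ K
    count≤K θ x zero    = z≤n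
    count≤K θ x (suc K) = ℕₚ.≤-trans (ℕₚ.+-monoʳ-≤ (count θ x K) (b2n≤1 _))
                            (ℕₚ.≤-trans (ℕₚ.≤-reflexive (ℕₚ.+-comm _ 1)) (s≤s (count≤K θ x K)))
    K<c : ℕ→ℚ K + θ < x → K ℕ.< c
    K<c q = ℕₚ.≰⇒> λ c≤K → ℚₚ.<-irrefl refl (ℚₚ.<-≤-trans (ℚₚ.≤-<-trans (c≤K+θ c≤K) q) x≤c)
      where
      c≤K+θ : c ℕ.≤ K → ℕ→ℚ c ≤ ℕ→ℚ K + θ
      c≤K+θ c≤K = ℚₚ.≤-trans (ℕ→ℚ-mono-≤ c≤K)
        (ℚₚ.≤-trans (ℚₚ.≤-reflexive (sym (ℚₚ.+-identityʳ (ℕ→ℚ K)))) (ℚₚ.+-monoʳ-≤ (ℕ→ℚ K) θ≥0))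
    by-cases : Dec (ℕ→ℚ K + θ < x) → count θ x (suc K) ℕ.≤ c
    by-cases (no  q) rewrite ltBit-false q =
      ℕₚ.≤-trans (ℕₚ.≤-reflexive (ℕₚ.+-identityʳ _)) (count-bound θ x c K θ≥0 x≤c)
    by-cases (yes q) rewrite ltBit-true q =
      ℕₚ.≤-trans (ℕₚ.≤-reflexive (ℕₚ.+-comm _ 1)) (ℕₚ.≤-trans (s≤s (count≤K θ x K)) (K<c q))

  count-unitStep : ∀ σ θ K a b → UnitStep σ a b →
                   UnitStep σ (ℕ→ℚ (count θ a K)) (ℕ→ℚ (count θ b K))
  count-unitStep false θ K a b s = unitStep-ℕ⁺ (count θ a K) (count θ b K)
    (count-mono θ K (proj₁ (unitStep-elim a b s)))
    (ℕₚ.≤-trans (count-mono θ K (proj₂ (unitStep-elim a b s))) (count-lipschitz θ a K))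
  count-unitStep true θ K a b s =
    unitStep-unflip (ℕ→ℚ (count θ a K)) (ℕ→ℚ (count θ b K))
      (count-unitStep false θ K b a (unitStep-flip a b s))

  -- For thresholds 0 = s₀ ≤ s₁ ≤ ... ≤ s_m ≤ 1 the
  -- staircase weights are s_{i+1} - s_i and 1 - s_m.  Averaging the bit
  -- [s < y] with these weights gives clamp01 y = min (max 0 y) 1 as soon as
  -- clamp01 y is a threshold; summing over y = x - k, k < K, gives min x K.

  staircase : List ℚ → List (ℚ × ℚ)
  staircase []           = []
  staircase (s ∷ [])     = (1ℚ - s , s) ∷ []
  staircase (s ∷ s' ∷ t) = (s' - s , s) ∷ staircase (s' ∷ t)

  wsum-zero : ∀ {A : Set} (ws : List (ℚ × A)) {φ : A → ℚ} →
              All (λ wp → φ (proj₂ wp) ≡ 0ℚ) ws → wsum ws φ ≡ 0ℚ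
  wsum-zero []             []       = refl
  wsum-zero ((w , p) ∷ ws) (e ∷ es) =
    trans (cong₂ (λ a s → w * a + s) e (wsum-zero ws es))
          (trans (ℚₚ.+-identityʳ (w * 0ℚ)) (ℚₚ.*-zeroʳ w))

  staircase-points : ∀ (P : ℚ → Set) t → All P t → All (λ p → P (proj₂ p)) (staircase t)
  staircase-points P []           []             = []
  staircase-points P (s ∷ [])     (p ∷ [])       = p ∷ []
  staircase-points P (s ∷ s' ∷ t) (p ∷ ps)       = p ∷ staircase-points P (s' ∷ t) ps

  staircase-weights : ∀ s t → AllPairs _≤_ (s ∷ t) → All (_≤ 1ℚ) (s ∷ t) →
                      All (λ p → 0ℚ ≤ proj₁ p) (staircase (s ∷ t))
  staircase-weights s []       _                (s≤1 ∷ [])  = ≤⇒0≤- s≤1 ∷ []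
  staircase-weights s (s' ∷ t) ((s≤s' ∷ _) ∷ st) (_ ∷ ≤1)   =
    ≤⇒0≤- s≤s' ∷ staircase-weights s' t st ≤1

  staircase-total : ∀ s t → wsum (staircase (s ∷ t)) (λ _ → 1ℚ) ≡ 1ℚ - s
  staircase-total s []       = total₁ s
    where
    total₁ : ∀ s → (1ℚ - s) * 1ℚ + 0ℚ ≡ 1ℚ - s
    total₁ = solve-∀ ℚ-ring
  staircase-total s (s' ∷ t) =
    trans (cong (λ v → (s' - s) * 1ℚ + v) (staircase-total s' t)) (telescope s s')
    where
    telescope : ∀ s s' → (s' - s) * 1ℚ + (1ℚ - s') ≡ 1ℚ - s
    telescope = solve-∀ ℚ-ring

  staircase-below : ∀ y t → All (y ≤_) t → wsum (staircase t) (λ s → bit (ltBit s y)) ≡ 0ℚ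
  staircase-below y t y≤ = wsum-zero (staircase t)
    (All.map (λ y≤s → cong bit (ltBit-false (λ s<y → ℚₚ.<-irrefl refl (ℚₚ.<-≤-trans s<y y≤s))))
             (staircase-points (y ≤_) t y≤))

  staircase-above : ∀ y s t → All (_< y) (s ∷ t) →
                    wsum (staircase (s ∷ t)) (λ s → bit (ltBit s y)) ≡ 1ℚ - s
  staircase-above y s t <y = trans
    (wsum-congᴬ (staircase (s ∷ t)) (All.map (λ s<y → cong bit (ltBit-true s<y))
                                              (staircase-points (_< y) (s ∷ t) <y)))
    (staircase-total s t)

  staircase-at : ∀ y s t → AllPairs _≤_ (s ∷ t) → y ∈ (s ∷ t) →
                 wsum (staircase (s ∷ t)) (λ s → bit (ltBit s y)) ≡ y - s
  staircase-at y s t (s≤ ∷ st) (here refl) =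
    trans (staircase-below y (s ∷ t) (ℚₚ.≤-refl ∷ s≤)) (sym (ℚₚ.+-inverseʳ y))
  staircase-at y s (s' ∷ t) ((s≤s' ∷ _) ∷ (s'≤ ∷ st)) (there y∈) = by-cases (s ℚₚ.<? y)
    where
    head≤ : ∀ {z} → z ∈ (s' ∷ t) → s' ≤ z
    head≤ (here refl) = ℚₚ.≤-refl
    head≤ (there z∈t) = All.lookup s'≤ z∈t
    s'≤y : s' ≤ y
    s'≤y = head≤ y∈
    rest : wsum (staircase (s' ∷ t)) (λ s → bit (ltBit s y)) ≡ y - s'
    rest = staircase-at y s' t (s'≤ ∷ st) y∈
    step₁ : ∀ s s' y → (s' - s) * 1ℚ + (y - s') ≡ y - s
    step₁ = solve-∀ ℚ-ring
    step₀ : ∀ s s' y → (s' - s) * 0ℚ + (y - s') ≡ y - s'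
    step₀ = solve-∀ ℚ-ring
    by-cases : Dec (s < y) → wsum (staircase (s ∷ s' ∷ t)) (λ s → bit (ltBit s y)) ≡ y - s
    by-cases (yes s<y) =
      trans (cong₂ (λ b v → (s' - s) * bit b + v) (ltBit-true s<y) rest) (step₁ s s' y)
    by-cases (no  s≮y) =
      trans (cong₂ (λ b v → (s' - s) * bit b + v) (ltBit-false s≮y) rest)
            (trans (step₀ s s' y) (cong (λ v → y - v) (sym s≡s')))
      where
      s≡s' : s ≡ s'
      s≡s' = ℚₚ.≤-antisym s≤s' (ℚₚ.≤-trans s'≤y (ℚₚ.≮⇒≥ s≮y))

  clamp01 : ℚ → ℚ
  clamp01 y = (0ℚ ⊔ y) ⊓ 1ℚ

  clamp01-bounds : ∀ y → 0ℚ ≤ clamp01 y × clamp01 y ≤ 1ℚ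
  clamp01-bounds y = ℚₚ.⊓-glb (ℚₚ.p≤p⊔q 0ℚ y) 0≤1 , ℚₚ.p⊓q≤q (0ℚ ⊔ y) 1ℚ

  staircase-clamp : ∀ t y → AllPairs _≤_ (0ℚ ∷ t) → All (λ s → 0ℚ ≤ s × s ≤ 1ℚ) (0ℚ ∷ t) →
                    clamp01 y ∈ (0ℚ ∷ t) →
                    wsum (staircase (0ℚ ∷ t)) (λ s → bit (ltBit s y)) ≡ clamp01 y
  staircase-clamp t y st bounds c∈ with y ℚₚ.≤? 0ℚ
  ... | yes y≤0 =
    trans (staircase-below y (0ℚ ∷ t) (All.map (λ b → ℚₚ.≤-trans y≤0 (proj₁ b)) bounds))
          (sym (trans (cong (_⊓ 1ℚ) (ℚₚ.p≥q⇒p⊔q≡p y≤0)) (ℚₚ.p≤q⇒p⊓q≡p 0≤1)))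
  ... | no  y≰0 with 1ℚ ℚₚ.<? y
  ...   | yes 1<y =
    trans (staircase-above y 0ℚ t (All.map (λ b → ℚₚ.≤-<-trans (proj₂ b) 1<y) bounds))
          (sym (trans (cong (_⊓ 1ℚ) (ℚₚ.p≤q⇒p⊔q≡q (ℚₚ.<⇒≤ (ℚₚ.≰⇒> y≰0))))
                      (ℚₚ.p≥q⇒p⊓q≡q (ℚₚ.<⇒≤ 1<y))))
  ...   | no  1≮y =
    trans (staircase-at y 0ℚ t st (subst (_∈ (0ℚ ∷ t)) clamp≡y c∈))
          (trans (ℚₚ.+-identityʳ y) (sym clamp≡y))
    where
    clamp≡y : clamp01 y ≡ y
    clamp≡y = trans (cong (_⊓ 1ℚ) (ℚₚ.p≤q⇒p⊔q≡q (ℚₚ.<⇒≤ (ℚₚ.≰⇒> y≰0))))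
                    (ℚₚ.p≤q⇒p⊓q≡p (ℚₚ.≮⇒≥ 1≮y))

  min-step : ∀ x k → x ⊓ k + clamp01 (x - k) ≡ x ⊓ (k + 1ℚ)
  min-step x k with x ℚₚ.≤? k
  ... | yes x≤k =
    trans (cong₂ _+_ (ℚₚ.p≤q⇒p⊓q≡p x≤k)
                     (trans (cong (_⊓ 1ℚ) (ℚₚ.p≥q⇒p⊔q≡p x-k≤0)) (ℚₚ.p≤q⇒p⊓q≡p 0≤1)))
          (trans (ℚₚ.+-identityʳ x) (sym (ℚₚ.p≤q⇒p⊓q≡p (ℚₚ.≤-trans x≤k k≤k+1))))
    where
    x-k≤0 : x - k ≤ 0ℚ
    x-k≤0 = ℚₚ.≤-trans (ℚₚ.+-monoˡ-≤ (- k) x≤k) (ℚₚ.≤-reflexive (ℚₚ.+-inverseʳ k))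
    k≤k+1 : k ≤ k + 1ℚ
    k≤k+1 = ℚₚ.≤-trans (ℚₚ.≤-reflexive (sym (ℚₚ.+-identityʳ k))) (ℚₚ.+-monoʳ-≤ k 0≤1)
  ... | no x≰k with x ℚₚ.≤? k + 1ℚ
  ...   | yes x≤k+1 =
    trans (cong₂ _+_ (ℚₚ.p≥q⇒p⊓q≡q k≤x)
                     (trans (cong (_⊓ 1ℚ) (ℚₚ.p≤q⇒p⊔q≡q (≤⇒0≤- k≤x))) (ℚₚ.p≤q⇒p⊓q≡p x-k≤1)))
          (trans (k+[x-k] k x) (sym (ℚₚ.p≤q⇒p⊓q≡p x≤k+1)))
    where
    k≤x : k ≤ x
    k≤x = ℚₚ.<⇒≤ (ℚₚ.≰⇒> x≰k)
    x-k≤1 : x - k ≤ 1ℚ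
    x-k≤1 = proj₂ (unitStep-intro k≤x x≤k+1)
    k+[x-k] : ∀ k x → k + (x - k) ≡ x
    k+[x-k] = solve-∀ ℚ-ring
  ...   | no x≰k+1 =
    trans (cong₂ _+_ (ℚₚ.p≥q⇒p⊓q≡q k≤x)
                     (trans (cong (_⊓ 1ℚ) (ℚₚ.p≤q⇒p⊔q≡q (≤⇒0≤- k≤x))) (ℚₚ.p≥q⇒p⊓q≡q 1≤x-k)))
          (sym (ℚₚ.p≥q⇒p⊓q≡q (ℚₚ.<⇒≤ (ℚₚ.≰⇒> x≰k+1))))
    where
    k≤x : k ≤ x
    k≤x = ℚₚ.<⇒≤ (ℚₚ.≰⇒> x≰k)
    k+1-k : ∀ k → 1ℚ ≡ k + 1ℚ - k
    k+1-k = solve-∀ ℚ-ring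
    1≤x-k : 1ℚ ≤ x - k
    1≤x-k = ℚₚ.≤-trans (ℚₚ.≤-reflexive (k+1-k k)) (ℚₚ.+-monoˡ-≤ (- k) (ℚₚ.<⇒≤ (ℚₚ.≰⇒> x≰k+1)))

  averageCount : List (ℚ × ℚ) → ℚ → ℕ → ℚ
  averageCount ps x K = wsum ps (λ s → ℕ→ℚ (count s x K))

  averageCount-suc : ∀ ps x K →
    averageCount ps x (suc K) ≡ averageCount ps x K + wsum ps (λ s → bit (ltBit s (x - ℕ→ℚ K)))
  averageCount-suc ps x K =
    trans (wsum-cong ps (λ s → trans (ℕ→ℚ-+ (count s x K) _)
                                     (cong (λ v → ℕ→ℚ (count s x K) + v) (trans (sym (bit≡ _))
                                                                         (cong bit (shift s))))))
          (sym (wsum-+ ps _ _))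
    where
    move : ∀ k s x → (k + s < x → s < x - k) × (s < x - k → k + s < x)
    move k s x =
      (λ p → subst₂ _<_ (cancel₁ k s) refl (ℚₚ.+-monoˡ-< (- k) p)) ,
      (λ p → subst₂ _<_ (ℚₚ.+-comm s k) (cancel₂ x k) (ℚₚ.+-monoˡ-< k p))
      where
      cancel₁ : ∀ k s → k + s - k ≡ s
      cancel₁ = solve-∀ ℚ-ring
      cancel₂ : ∀ x k → x - k + k ≡ x
      cancel₂ = solve-∀ ℚ-ring
    shift : ∀ s → ltBit (ℕ→ℚ K + s) x ≡ ltBit s (x - ℕ→ℚ K)
    shift s = ltBit-cong (proj₁ (move (ℕ→ℚ K) s x)) (proj₂ (move (ℕ→ℚ K) s x))

  averageCount-staircase : ∀ t x K → 0ℚ ≤ x → AllPairs _≤_ (0ℚ ∷ t) →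
    All (λ s → 0ℚ ≤ s × s ≤ 1ℚ) (0ℚ ∷ t) →
    (∀ k → k ℕ.< K → clamp01 (x - ℕ→ℚ k) ∈ (0ℚ ∷ t)) →
    averageCount (staircase (0ℚ ∷ t)) x K ≡ x ⊓ ℕ→ℚ K
  averageCount-staircase t x zero    x≥0 st bounds thr =
    trans (wsum-zero (staircase (0ℚ ∷ t)) (All.universal (λ _ → refl) _))
          (sym (ℚₚ.p≥q⇒p⊓q≡q x≥0))
  averageCount-staircase t x (suc K) x≥0 st bounds thr = begin
    averageCount (staircase (0ℚ ∷ t)) x (suc K)
      ≡⟨ averageCount-suc (staircase (0ℚ ∷ t)) x K ⟩
    averageCount (staircase (0ℚ ∷ t)) x K + wsum (staircase (0ℚ ∷ t)) (λ s → bit (ltBit s (x - ℕ→ℚ K)))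
      ≡⟨ cong₂ _+_ (averageCount-staircase t x K x≥0 st bounds (λ k k<K → thr k (ℕₚ.m<n⇒m<1+n k<K)))
                   (staircase-clamp t (x - ℕ→ℚ K) st bounds (thr K ℕₚ.≤-refl)) ⟩
    x ⊓ ℕ→ℚ K + clamp01 (x - ℕ→ℚ K)
      ≡⟨ min-step x (ℕ→ℚ K) ⟩
    x ⊓ (ℕ→ℚ K + 1ℚ)
      ≡⟨ cong (x ⊓_) (sym (ℕ→ℚ-suc K)) ⟩
    x ⊓ ℕ→ℚ (suc K) ∎
    where open ≡-Reasoning

  cons : ∀ {m} → ℕ → (Fin m → ℕ) → Fin (suc m) → ℕ
  cons a v Fin.zero    = a
  cons a v (Fin.suc i) = v i

  natBox : (m B : ℕ) → List (Fin m → ℕ)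
  natBox zero    B = (λ ()) ∷ []
  natBox (suc m) B = cartesianProductWith (λ (a : Fin (suc B)) v → cons (toℕ a) v)
                                          (allFin (suc B)) (natBox m B)

  natBox-complete : ∀ m B (v : Fin m → ℕ) → (∀ i → v i ℕ.≤ B) →
                    Σ (Fin m → ℕ) λ u → u ∈ natBox m B × (∀ i → u i ≡ v i)
  natBox-complete zero    B v v≤B = (λ ()) , here refl , (λ ())
  natBox-complete (suc m) B v v≤B with natBox-complete m B (λ i → v (Fin.suc i)) (λ i → v≤B (Fin.suc i))
  ... | u , u∈ , u≡ =
    cons (toℕ a) u ,
    ∈-cartesianProductWith⁺ (λ (a : Fin (suc B)) v → cons (toℕ a) v) (∈-allFin a) u∈ ,
    agree
    where
    a : Fin (suc B)
    a = fromℕ< (s≤s (v≤B Fin.zero))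
    agree : ∀ i → cons (toℕ a) u i ≡ v i
    agree Fin.zero    = Finₚ.toℕ-fromℕ< (s≤s (v≤B Fin.zero))
    agree (Fin.suc i) = u≡ i

  bounded? : ∀ (P : ℕ → Set) → (∀ j → Dec (P j)) → ∀ K → Dec (∀ j → j ℕ.< K → P j)
  bounded? P P? K = map′
    (λ all j j<K → subst P (Finₚ.toℕ-fromℕ< j<K) (all (fromℕ< j<K)))
    (λ all i → all (toℕ i) (Finₚ.toℕ<n i))
    (Finₚ.all? (λ i → P? (toℕ i)))

  height-suc : ∀ {n} (P : StepVec n) k → height P (suc k) ≡ height P k ℕ.+ b2n (at false P k)
  height-suc P k = cong (λ b → height P k ℕ.+ b2n b) (getℕ≡at false P k)

  heightℚ-suc : ∀ {n} (P : StepVec n) k →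
                ℕ→ℚ (height P (suc k)) ≡ ℕ→ℚ (height P k) + bit (at false P k)
  heightℚ-suc P k =
    trans (cong ℕ→ℚ (height-suc P k))
          (trans (ℕ→ℚ-+ (height P k) _) (cong (λ v → ℕ→ℚ (height P k) + v) (sym (bit≡ _))))

  Σ<-indicator : ∀ {n} (P : StepVec n) c → Σ< (at 0ℚ (indicator P)) c ≡ ℕ→ℚ (height P c)
  Σ<-indicator P zero    = refl
  Σ<-indicator P (suc c) =
    trans (cong₂ _+_ (Σ<-indicator P c) (at-map bit false P c)) (sym (heightℚ-suc P c))

  height-unit : ∀ {n} (P : StepVec n) k → height P k ℕ.≤ height P (suc k) × height P (suc k) ℕ.≤ suc (height P k)
  height-unit P k rewrite height-suc P k =
    ℕₚ.m≤m+n _ _ ,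
    ℕₚ.≤-trans (ℕₚ.+-monoʳ-≤ (height P k) (b2n≤1 _)) (ℕₚ.≤-reflexive (ℕₚ.+-comm (height P k) 1))

  height-≤ : ∀ {n} (P : StepVec n) k → height P k ℕ.≤ k
  height-≤ P zero    = z≤n
  height-≤ P (suc k) = ℕₚ.≤-trans (proj₂ (height-unit P k)) (s≤s (height-≤ P k))

  -- Adding a common height h to both ends preserves a unit step; a step
  -- of L adds 0 or 1 to h.
  ascend-by : ∀ a b h → a ℕ.≤ b → b ℕ.≤ suc a →
              a ℕ.+ h ℕ.≤ b ℕ.+ (h ℕ.+ 0) × b ℕ.+ (h ℕ.+ 0) ℕ.≤ suc (a ℕ.+ h)
  ascend-by a b h a≤b b≤a+1 rewrite ℕₚ.+-identityʳ h = ℕₚ.+-monoˡ-≤ h a≤b , ℕₚ.+-monoˡ-≤ h b≤a+1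

  descend-by : ∀ a b h → b ℕ.≤ a → a ℕ.≤ suc b →
               a ℕ.+ h ℕ.≤ b ℕ.+ (h ℕ.+ 1) × b ℕ.+ (h ℕ.+ 1) ℕ.≤ suc (a ℕ.+ h)
  descend-by a b h b≤a a≤b+1 rewrite ℕₚ.+-comm h 1 | ℕₚ.+-suc b h =
    ℕₚ.+-monoˡ-≤ h a≤b+1 , s≤s (ℕₚ.+-monoˡ-≤ h b≤a)

  pathOf : ∀ n → (ℕ → ℕ) → StepVec n
  pathOf n H i = does (H (toℕ i) ℕ.<? H (suc (toℕ i)))

  height-pathOf : ∀ n (H : ℕ → ℕ) → H 0 ≡ 0 →
                  (∀ k → k ℕ.< n → H k ℕ.≤ H (suc k) × H (suc k) ℕ.≤ suc (H k)) →
                  ∀ k → k ℕ.≤ n → height (pathOf n H) k ≡ H k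
  height-pathOf n H H0 unit zero    _   = sym H0
  height-pathOf n H H0 unit (suc k) k<n = begin
    height (pathOf n H) (suc k)                                 ≡⟨ height-suc (pathOf n H) k ⟩
    height (pathOf n H) k ℕ.+ b2n (at false (pathOf n H) k)
      ≡⟨ cong₂ ℕ._+_ (height-pathOf n H H0 unit k (ℕₚ.<⇒≤ k<n))
                     (cong b2n (at-tabulate false (λ j → does (H j ℕ.<? H (suc j))) k k<n)) ⟩
    H k ℕ.+ b2n (does (H k ℕ.<? H (suc k)))                     ≡⟨ step (H k ℕ.<? H (suc k)) ⟩
    H (suc k)                                                   ∎
    where
    open ≡-Reasoning
    step : (h? : Dec (H k ℕ.< H (suc k))) → H k ℕ.+ b2n (does h?) ≡ H (suc k)
    step (yes h<) = trans (ℕₚ.+-comm (H k) 1) (ℕₚ.≤-antisym h< (proj₂ (unit k k<n)))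
    step (no  h≮) = trans (ℕₚ.+-identityʳ (H k)) (ℕₚ.≤-antisym (proj₁ (unit k k<n)) (ℕₚ.≮⇒≥ h≮))

  module PathPolytope (r m : ℕ) (U L : StepVec (r ℕ.+ m))
                      (U-end : IsPath r m U) (L-end : IsPath r m L) (L≤U : NeverAbove L U) where

    n d : ℕ
    n = r ℕ.+ m
    d = n ℕ.∸ 1

    hU hL : ℕ → ℕ
    hU = height U
    hL = height L

    d≤n : d ℕ.≤ n
    d≤n = ℕₚ.m∸n≤m n 1

    suc-toℕ≤n : ∀ (j : Fin d) → suc (toℕ j) ℕ.≤ n
    suc-toℕ≤n j = ℕₚ.≤-trans (Finₚ.toℕ<n j) d≤n

    beyond-d : ∀ k → k ℕ.< n → ¬ (k ℕ.< d) → suc k ≡ n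
    beyond-d k k<n k≮d = go n k k<n k≮d
      where
      go : ∀ n k → k ℕ.< n → ¬ (k ℕ.< n ℕ.∸ 1) → suc k ≡ n
      go (suc n) k (s≤s k≤n) k≮n = cong suc (ℕₚ.≤-antisym k≤n (ℕₚ.≮⇒≥ k≮n))

    bound : ℕ → ℚ
    bound k = ℕ→ℚ (hU (suc k)) - ℕ→ℚ (hL (suc k))

    -- Q_M with the lookups getℕ replaced by at.
    InQ : Pt d → Set
    InQ q = (∀ j → suc j ℕ.< d → UnitStep (at false L (suc j)) (at 0ℚ q j) (at 0ℚ q (suc j)))
          × (∀ (j : Fin d) → 0ℚ ≤ q j × q j ≤ bound (toℕ j))

    lookups≡ : ∀ (q : Pt d) j → signed (getℕ false L (suc j)) (getℕ 0ℚ q (suc j) - getℕ 0ℚ q j)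
                     ≡ signed (at false L (suc j)) (at 0ℚ q (suc j) - at 0ℚ q j)
    lookups≡ q j = cong₂ signed (getℕ≡at false L (suc j))
                                (cong₂ _-_ (getℕ≡at 0ℚ q (suc j)) (getℕ≡at 0ℚ q j))

    Q-M⇒InQ : ∀ q → Q-M r m U L q → InQ q
    Q-M⇒InQ q (steps , bounds) =
      (λ j j+1<d → subst (λ v → 0ℚ ≤ v × v ≤ 1ℚ) (lookups≡ q j) (steps j j+1<d)) , bounds

    InQ⇒Q-M : ∀ q → InQ q → Q-M r m U L q
    InQ⇒Q-M q (steps , bounds) =
      (λ j j+1<d → subst (λ v → 0ℚ ≤ v × v ≤ 1ℚ) (sym (lookups≡ q j)) (steps j j+1<d)) , bounds

    InQ-resp : ∀ {q q'} → q ≐ q' → InQ q → InQ q'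
    InQ-resp q≐q' (steps , bounds) =
      (λ j j+1<d → subst₂ (UnitStep (at false L (suc j))) (at-cong 0ℚ q≐q' j) (at-cong 0ℚ q≐q' (suc j))
                          (steps j j+1<d)) ,
      (λ j → subst (λ v → 0ℚ ≤ v × v ≤ bound (toℕ j)) (q≐q' j) (bounds j))

    -- Q_M is convex: its constraints bound affine functionals.
    InQ-hull : ∀ q → InConvHull InQ q → InQ q
    InQ-hull q hull =
      (λ j j+1<d → hull-bounds 0ℚ 1ℚ
                     (affine-signed (at false L (suc j)) (affine-- (affine-at (suc j)) (affine-at j)))
                     (λ p hp → proj₁ hp j j+1<d) q hull) ,
      (λ j → hull-bounds 0ℚ (bound (toℕ j)) (affine-coord j) (λ p hp → proj₂ hp j) q hull)

    -- profile x k = x_0 + ... + x_{k-1} - h_L(k); for the indicator vector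
    -- of a path P this is the height of P above L after k steps.
    profile : Pt n → ℕ → ℚ
    profile x k = Σ< (at 0ℚ x) k - ℕ→ℚ (hL k)

    affine-profile : ∀ k → Affine (λ x → profile x k)
    affine-profile k = affine-- (affine-Σ< (λ k x → at 0ℚ x k) affine-at k) (affine-const _)

    f : AffineMap n d
    f = affine (λ j → prefixRow (suc (toℕ j))) (λ j → - ℕ→ℚ (hL (suc (toℕ j))))

    apply-f : ∀ x j → apply f x j ≡ profile x (suc (toℕ j))
    apply-f x j = cong (_+ (- ℕ→ℚ (hL (suc (toℕ j))))) (dot-prefixRow (suc (toℕ j)) x (suc-toℕ≤n j))

    affine-f : ∀ j → Affine (λ x → apply f x j)
    affine-f j = affine-≗ (λ x → apply-f x j) (affine-profile (suc (toℕ j)))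

    -- A point of Q_M as the full height profile: ext q 0 = 0 and ext q k = 0
    -- for k > d, matching profile x at both ends of the path.
    ext : Pt d → ℕ → ℚ
    ext q zero    = 0ℚ
    ext q (suc k) = at 0ℚ q k

    affine-ext : ∀ k → Affine (λ q → ext q k)
    affine-ext zero    = affine-const 0ℚ
    affine-ext (suc k) = affine-at k

    -- g q is the discrete derivative of the heights ext q + h_L.
    derivative : Pt d → ℕ → ℚ
    derivative q k = ext q (suc k) - ext q k + bit (at false L k)

    g : Pt d → Pt n
    g q i = derivative q (toℕ i)

    affine-g : ∀ i → Affine (λ q → g q i)
    affine-g i = affine-+ (affine-- (affine-ext (suc (toℕ i))) (affine-ext (toℕ i))) (affine-const _)

    Σ<-derivative : ∀ q k → Σ< (derivative q) k ≡ ext q k + ℕ→ℚ (hL k)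
    Σ<-derivative q zero    = refl
    Σ<-derivative q (suc k) = begin
      Σ< (derivative q) k + derivative q k
        ≡⟨ cong (_+ derivative q k) (Σ<-derivative q k) ⟩
      ext q k + ℕ→ℚ (hL k) + (ext q (suc k) - ext q k + bit (at false L k))
        ≡⟨ telescope (ext q k) (ℕ→ℚ (hL k)) (ext q (suc k)) (bit (at false L k)) ⟩
      ext q (suc k) + (ℕ→ℚ (hL k) + bit (at false L k))
        ≡⟨ cong (ext q (suc k) +_) (sym (heightℚ-suc L k)) ⟩
      ext q (suc k) + ℕ→ℚ (hL (suc k)) ∎
      where
      open ≡-Reasoning
      telescope : ∀ e h e' l → e + h + (e' - e + l) ≡ e' + (h + l)
      telescope = solve-∀ ℚ-ring

    profile-g : ∀ q k → k ℕ.≤ n → profile (g q) k ≡ ext q k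
    profile-g q k k≤n = begin
      Σ< (at 0ℚ (g q)) k - ℕ→ℚ (hL k)
        ≡⟨ cong (_- ℕ→ℚ (hL k))
                (Σ<-cong _ _ k (λ j j<k → at-tabulate 0ℚ (derivative q) j (ℕₚ.<-≤-trans j<k k≤n))) ⟩
      Σ< (derivative q) k - ℕ→ℚ (hL k)
        ≡⟨ cong (_- ℕ→ℚ (hL k)) (Σ<-derivative q k) ⟩
      ext q k + ℕ→ℚ (hL k) - ℕ→ℚ (hL k)
        ≡⟨ cancel (ext q k) (ℕ→ℚ (hL k)) ⟩
      ext q k ∎
      where
      open ≡-Reasoning
      cancel : ∀ e h → e + h - h ≡ e
      cancel = solve-∀ ℚ-ring

    f∘g : ∀ q → apply f (g q) ≐ q
    f∘g q j = trans (apply-f (g q) j) (trans (profile-g q (suc (toℕ j)) (suc-toℕ≤n j)) (at-toℕ 0ℚ q j))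

    ext-f : ∀ x → Σ< (at 0ℚ x) n ≡ ℕ→ℚ r → ∀ k → k ℕ.≤ n → ext (apply f x) k ≡ profile x k
    ext-f x Σx=r zero    _   = refl
    ext-f x Σx=r (suc k) k<n with k ℕ.<? d
    ... | yes k<d = trans (at-cong 0ℚ (apply-f x) k) (at-tabulate 0ℚ (λ j → profile x (suc j)) k k<d)
    ... | no  k≮d = begin
      at 0ℚ (apply f x) k             ≡⟨ at-out 0ℚ (apply f x) k (ℕₚ.≮⇒≥ k≮d) ⟩
      0ℚ                              ≡⟨ sym (ℚₚ.+-inverseʳ (ℕ→ℚ r)) ⟩
      ℕ→ℚ r - ℕ→ℚ r                   ≡⟨ cong₂ _-_ (sym Σx=r) (cong ℕ→ℚ (sym L-end)) ⟩
      Σ< (at 0ℚ x) n - ℕ→ℚ (hL n)     ≡⟨ cong (profile x) (sym (beyond-d k k<n k≮d)) ⟩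
      profile x (suc k)               ∎
      where open ≡-Reasoning

    g∘f : ∀ x → Σ< (at 0ℚ x) n ≡ ℕ→ℚ r → g (apply f x) ≐ x
    g∘f x Σx=r i = begin
      ext (apply f x) (suc k) - ext (apply f x) k + bit (at false L k)
        ≡⟨ cong₂ (λ a b → a - b + bit (at false L k)) (ext-f x Σx=r (suc k) (Finₚ.toℕ<n i))
                                                       (ext-f x Σx=r k (ℕₚ.<⇒≤ (Finₚ.toℕ<n i))) ⟩
      profile x (suc k) - profile x k + bit (at false L k)
        ≡⟨ cong (λ h → Σ< (at 0ℚ x) (suc k) - h - profile x k + bit (at false L k)) (heightℚ-suc L k) ⟩
      Σ< (at 0ℚ x) k + at 0ℚ x k - (ℕ→ℚ (hL k) + bit (at false L k)) - (Σ< (at 0ℚ x) k - ℕ→ℚ (hL k)) + bit (at false L k)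
        ≡⟨ cancel (Σ< (at 0ℚ x) k) (at 0ℚ x k) (ℕ→ℚ (hL k)) (bit (at false L k)) ⟩
      at 0ℚ x k
        ≡⟨ at-toℕ 0ℚ x i ⟩
      x i ∎
      where
      open ≡-Reasoning
      k = toℕ i
      cancel : ∀ s a h l → s + a - (h + l) - (s - h) + l ≡ a
      cancel = solve-∀ ℚ-ring

    Vertex : Pt n → Set
    Vertex x = Σ (StepVec n) λ P → IsBasisPath r m U L P × x ≐ indicator P

    Σ<-P-M : ∀ x → P-M r m U L x → Σ< (at 0ℚ x) n ≡ ℕ→ℚ r
    Σ<-P-M x x∈P = ℚₚ.≤-antisym (proj₂ bounds) (proj₁ bounds)
      where
      on-vertices : ∀ p → Vertex p → ℕ→ℚ r ≤ Σ< (at 0ℚ p) n × Σ< (at 0ℚ p) n ≤ ℕ→ℚ r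
      on-vertices p (P , (P-end , _) , p≐) = ℚₚ.≤-reflexive (sym Σp=r) , ℚₚ.≤-reflexive Σp=r
        where
        Σp=r : Σ< (at 0ℚ p) n ≡ ℕ→ℚ r
        Σp=r = trans (Σ<-cong _ _ n (λ k _ → at-cong 0ℚ p≐ k))
                     (trans (Σ<-indicator P n) (cong ℕ→ℚ P-end))
      bounds = hull-bounds (ℕ→ℚ r) (ℕ→ℚ r) (affine-Σ< (λ k x → at 0ℚ x k) affine-at n) on-vertices x x∈P

    ext-f-path : ∀ (P : StepVec n) → height P n ≡ r → ∀ k → k ℕ.≤ n →
                 ext (apply f (indicator P)) k ≡ ℕ→ℚ (height P k) - ℕ→ℚ (hL k)
    ext-f-path P P-end k k≤n =
      trans (ext-f (indicator P) (trans (Σ<-indicator P n) (cong ℕ→ℚ P-end)) k k≤n)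
            (cong (_- ℕ→ℚ (hL k)) (Σ<-indicator P k))

    height-gap-step : ∀ (P : StepVec n) k →
      (ℕ→ℚ (height P (suc k)) - ℕ→ℚ (hL (suc k))) - (ℕ→ℚ (height P k) - ℕ→ℚ (hL k))
                              ≡ bit (at false P k) - bit (at false L k)
    height-gap-step P k =
      trans (cong₂ (λ a b → a - b - (ℕ→ℚ (height P k) - ℕ→ℚ (hL k))) (heightℚ-suc P k) (heightℚ-suc L k))
            (cancel (ℕ→ℚ (height P k)) (ℕ→ℚ (hL k)) (bit (at false P k)) (bit (at false L k)))
      where
      cancel : ∀ a b c e → a + c - (b + e) - (a - b) ≡ c - e
      cancel = solve-∀ ℚ-ring

    -- Basis paths are mapped into Q_M: the steps of P - L are 0 or ±1 with
    -- the sign of L's step, and L ≤ P ≤ U gives the bounds.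
    vertex-in-Q : ∀ (P : StepVec n) → IsBasisPath r m U L P → InQ (apply f (indicator P))
    vertex-in-Q P (P-end , P≤U , L≤P) = steps , bounds
      where
      y = apply f (indicator P)
      gap : ∀ k → k ℕ.≤ n → ext y k ≡ ℕ→ℚ (height P k) - ℕ→ℚ (hL k)
      gap = ext-f-path P P-end
      steps : ∀ j → suc j ℕ.< d → UnitStep (at false L (suc j)) (at 0ℚ y j) (at 0ℚ y (suc j))
      steps j j+1<d = subst (λ v → 0ℚ ≤ signed σ v × signed σ v ≤ 1ℚ) (sym difference)
                            (unitStep-bits (at false P (suc j)) σ)
        where
        σ = at false L (suc j)
        j+2≤n : suc (suc j) ℕ.≤ n
        j+2≤n = ℕₚ.≤-trans j+1<d d≤n
        difference : ext y (suc (suc j)) - ext y (suc j) ≡ bit (at false P (suc j)) - bit σ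
        difference = trans (cong₂ _-_ (gap (suc (suc j)) j+2≤n) (gap (suc j) (ℕₚ.<⇒≤ j+2≤n)))
                           (height-gap-step P (suc j))
      bounds : ∀ (j : Fin d) → 0ℚ ≤ y j × y j ≤ bound (toℕ j)
      bounds j = subst (λ v → 0ℚ ≤ v × v ≤ bound (toℕ j)) (sym y-j)
        (≤⇒0≤- (ℕ→ℚ-mono-≤ (L≤P k k≤n)) , ℚₚ.+-monoˡ-≤ (- ℕ→ℚ (hL k)) (ℕ→ℚ-mono-≤ (P≤U k k≤n)))
        where
        k = suc (toℕ j)
        k≤n = suc-toℕ≤n j
        y-j : y j ≡ ℕ→ℚ (height P k) - ℕ→ℚ (hL k)
        y-j = trans (sym (at-toℕ 0ℚ y j)) (gap k k≤n)

    f-cong : ∀ {x x'} → x ≐ x' → apply f x ≐ apply f x'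
    f-cong x≐x' j = proj₁ (affine-f j) x≐x'

    g-cong : ∀ {q q'} → q ≐ q' → g q ≐ g q'
    g-cong q≐q' i = proj₁ (affine-g i) q≐q'

    -- f maps P_M into Q_M since Q_M is convex.
    f-into-Q : ∀ x → P-M r m U L x → InQ (apply f x)
    f-into-Q x x∈P = InQ-hull (apply f x) (hull-image (apply f) affine-f vertex x x∈P)
      where
      vertex : ∀ p → Vertex p → InQ (apply f p)
      vertex p (P , basis , p≐) = InQ-resp (f-cong (λ i → sym (p≐ i))) (vertex-in-Q P basis)

    -- f is injective on P_M since g inverts it there.
    f-injective : ∀ x x' → P-M r m U L x → P-M r m U L x' → apply f x ≐ apply f x' → x ≐ x'
    f-injective x x' x∈P x'∈P fx≐fx' i =
      trans (sym (g∘f x (Σ<-P-M x x∈P) i)) (trans (g-cong fx≐fx' i) (g∘f x' (Σ<-P-M x' x'∈P) i))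

    -- Every integer point of Q_M is the image of a basis path: the heights
    -- ext v + h_L move by unit steps, so they are the heights of a path,
    -- and that path lies between L and U.

    natPt : (Fin d → ℕ) → Pt d
    natPt v j = ℕ→ℚ (v j)

    module IntegerPoint (v : Fin d → ℕ) (v∈Q : InQ (natPt v)) where

      extℕ : ℕ → ℕ
      extℕ zero    = 0
      extℕ (suc k) = at 0 v k

      ext-natPt : ∀ k → ext (natPt v) k ≡ ℕ→ℚ (extℕ k)
      ext-natPt zero    = refl
      ext-natPt (suc k) = at-map ℕ→ℚ 0 v k

      extℕ-beyond : ∀ k → n ℕ.≤ k → extℕ k ≡ 0
      extℕ-beyond zero    _   = refl
      extℕ-beyond (suc k) n≤k = at-out 0 v k (ℕₚ.∸-monoˡ-≤ 1 n≤k)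

      extℕ-end : extℕ n ≡ 0
      extℕ-end = extℕ-beyond n ℕₚ.≤-refl

      H : ℕ → ℕ
      H k = extℕ k ℕ.+ hL k

      -- the candidate heights stay below U: inside by the bounds of Q_M,
      -- outside because there they are the heights of L
      below-U : ∀ k → k ℕ.≤ n → H k ℕ.≤ hU k
      below-U zero    _   = z≤n
      below-U (suc k) k<n = by-cases (k ℕ.<? d)
        where
        by-cases : Dec (k ℕ.< d) → H (suc k) ℕ.≤ hU (suc k)
        by-cases (yes k<d) = ℕ→ℚ-cancel-≤ {at 0 v k ℕ.+ hL (suc k)} {hU (suc k)}
          (ℚₚ.≤-trans (ℚₚ.≤-reflexive (ℕ→ℚ-+ (at 0 v k) (hL (suc k))))
                      (≤-⇒+≤ {ℕ→ℚ (hL (suc k))} {ℕ→ℚ (hU (suc k))} v-k≤))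
          where
          v-k≤ : ℕ→ℚ (at 0 v k) ≤ bound k
          v-k≤ = subst₂ (λ a b → ℕ→ℚ a ≤ bound b) (sym (at-fromℕ< 0 v k k<d)) (Finₚ.toℕ-fromℕ< k<d)
                        (proj₂ (proj₂ v∈Q (fromℕ< k<d)))
        by-cases (no  k≮d) =
          subst (λ e → e ℕ.+ hL (suc k) ℕ.≤ hU (suc k)) (sym (at-out 0 v k (ℕₚ.≮⇒≥ k≮d))) (L≤U (suc k) k<n)

      interior-unit : ∀ k → suc k ℕ.< d → H (suc k) ℕ.≤ H (suc (suc k)) × H (suc (suc k)) ℕ.≤ suc (H (suc k))
      interior-unit k k+1<d =
        subst (λ h' → a ℕ.+ h ℕ.≤ b ℕ.+ h' × b ℕ.+ h' ℕ.≤ suc (a ℕ.+ h)) (sym (height-suc L (suc k)))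
              (by-sign (at false L (suc k)) refl)
        where
        a b h : ℕ
        a = at 0 v k
        b = at 0 v (suc k)
        h = hL (suc k)
        step : UnitStep (at false L (suc k)) (ℕ→ℚ a) (ℕ→ℚ b)
        step = subst₂ (UnitStep (at false L (suc k))) (at-map ℕ→ℚ 0 v k) (at-map ℕ→ℚ 0 v (suc k))
                      (proj₁ v∈Q k k+1<d)
        by-sign : ∀ σ → at false L (suc k) ≡ σ →
                  a ℕ.+ h ℕ.≤ b ℕ.+ (h ℕ.+ b2n σ) × b ℕ.+ (h ℕ.+ b2n σ) ℕ.≤ suc (a ℕ.+ h)
        by-sign false σ≡ = uncurry (ascend-by a b h)
          (unitStep-ℕ⁻ a b (subst (λ σ → UnitStep σ (ℕ→ℚ a) (ℕ→ℚ b)) σ≡ step))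
        by-sign true  σ≡ = uncurry (descend-by a b h)
          (unitStep-ℕ⁻ b a (unitStep-flip (ℕ→ℚ a) (ℕ→ℚ b) (subst (λ σ → UnitStep σ (ℕ→ℚ a) (ℕ→ℚ b)) σ≡ step)))

      -- all steps are unit: the first because H 1 ≤ h_U 1 ≤ 1, the last
      -- because H ends at r = h_U n, the others by the constraints of Q_M
      H-unit : ∀ k → k ℕ.< n → H k ℕ.≤ H (suc k) × H (suc k) ℕ.≤ suc (H k)
      H-unit zero    0<n   = z≤n , ℕₚ.≤-trans (below-U 1 0<n) (height-≤ U 1)
      H-unit (suc k) k+1<n = by-cases (suc k ℕ.<? d)
        where
        by-cases : Dec (suc k ℕ.< d) → H (suc k) ℕ.≤ H (suc (suc k)) × H (suc (suc k)) ℕ.≤ suc (H (suc k))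
        by-cases (yes k+1<d) = interior-unit k k+1<d
        by-cases (no  k+1≮d) = last-up , last-unit
          where
          k+2≡n : suc (suc k) ≡ n
          k+2≡n = beyond-d (suc k) k+1<n k+1≮d
          H-end : H (suc (suc k)) ≡ r
          H-end = trans (cong H k+2≡n) (trans (cong (ℕ._+ hL n) extℕ-end) L-end)
          last-up : H (suc k) ℕ.≤ H (suc (suc k))
          last-up = ℕₚ.≤-trans (below-U (suc k) (ℕₚ.<⇒≤ k+1<n))
                      (ℕₚ.≤-trans (proj₁ (height-unit U (suc k)))
                        (ℕₚ.≤-reflexive (trans (cong hU k+2≡n) (trans U-end (sym H-end)))))
          last-unit : H (suc (suc k)) ℕ.≤ suc (H (suc k))
          last-unit = ℕₚ.≤-trans (ℕₚ.≤-reflexive (trans H-end (sym (trans (cong hL k+2≡n) L-end))))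
                        (ℕₚ.≤-trans (proj₂ (height-unit L (suc k))) (s≤s (ℕₚ.m≤n+m _ (extℕ (suc k)))))

      P : StepVec n
      P = pathOf n H

      height-P : ∀ k → k ℕ.≤ n → height P k ≡ H k
      height-P = height-pathOf n H refl H-unit

      basis : IsBasisPath r m U L P
      basis = trans (height-P n ℕₚ.≤-refl) (trans (cong (ℕ._+ hL n) extℕ-end) L-end) ,
              (λ k k≤n → subst (ℕ._≤ hU k) (sym (height-P k k≤n)) (below-U k k≤n)) ,
              (λ k k≤n → subst (hL k ℕ.≤_) (sym (height-P k k≤n)) (ℕₚ.m≤n+m (hL k) (extℕ k)))

      heightℚ-P : ∀ k → k ℕ.≤ n → ℕ→ℚ (height P k) ≡ ext (natPt v) k + ℕ→ℚ (hL k)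
      heightℚ-P k k≤n = trans (cong ℕ→ℚ (height-P k k≤n))
                              (trans (ℕ→ℚ-+ (extℕ k) (hL k)) (cong (_+ ℕ→ℚ (hL k)) (sym (ext-natPt k))))

      -- g v is the indicator of P: both are the steps of ext v + h_L
      g-indicator : g (natPt v) ≐ indicator P
      g-indicator i = begin
        ext (natPt v) (suc k) - ext (natPt v) k + bit (at false L k)
          ≡⟨ regroup (ext (natPt v) (suc k)) (ext (natPt v) k) (ℕ→ℚ (hL k)) (bit (at false L k)) ⟩
        (ext (natPt v) (suc k) + (ℕ→ℚ (hL k) + bit (at false L k))) - (ext (natPt v) k + ℕ→ℚ (hL k))
          ≡⟨ cong₂ (λ a b → (ext (natPt v) (suc k) + a) - b) (sym (heightℚ-suc L k))
                                                               (sym (heightℚ-P k (ℕₚ.<⇒≤ k<n))) ⟩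
        (ext (natPt v) (suc k) + ℕ→ℚ (hL (suc k))) - ℕ→ℚ (height P k)
          ≡⟨ cong (_- ℕ→ℚ (height P k)) (sym (heightℚ-P (suc k) k<n)) ⟩
        ℕ→ℚ (height P (suc k)) - ℕ→ℚ (height P k)
          ≡⟨ cong (_- ℕ→ℚ (height P k)) (heightℚ-suc P k) ⟩
        ℕ→ℚ (height P k) + bit (at false P k) - ℕ→ℚ (height P k)
          ≡⟨ cancel (ℕ→ℚ (height P k)) (bit (at false P k)) ⟩
        bit (at false P k)
          ≡⟨ cong bit (at-toℕ false P i) ⟩
        indicator P i ∎
        where
        open ≡-Reasoning
        k = toℕ i
        k<n = Finₚ.toℕ<n i
        regroup : ∀ e' e h l → e' - e + l ≡ (e' + (h + l)) - (e + h)
        regroup = solve-∀ ℚ-ring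
        cancel : ∀ a b → a + b - a ≡ b
        cancel = solve-∀ ℚ-ring

    integer-point : ∀ v → InQ (natPt v) → Vertex (g (natPt v))
    integer-point v v∈Q = P , basis , g-indicator
      where open IntegerPoint v v∈Q

    -- Every point of Q_M is a convex combination of integer points of Q_M:
    -- round all coordinates at a common threshold θ, and average over the
    -- staircase of thresholds formed by the fractional parts of q.

    IntegerPt : Pt d → Set
    IntegerPt p = Σ (Fin d → ℕ) λ v → InQ (natPt v) × p ≐ natPt v

    roundAt : ℚ → Pt d → Fin d → ℕ
    roundAt θ q j = count θ (q j) n

    bound-ℕ : ∀ (j : Fin d) → bound (toℕ j) ≡ ℕ→ℚ (hU (suc (toℕ j)) ℕ.∸ hL (suc (toℕ j)))
    bound-ℕ j = sym (ℕ→ℚ-∸ (hU (suc (toℕ j))) (hL (suc (toℕ j))) (L≤U (suc (toℕ j)) (suc-toℕ≤n j)))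

    roundAt-in-Q : ∀ θ q → 0ℚ ≤ θ → InQ q → InQ (natPt (roundAt θ q))
    roundAt-in-Q θ q θ≥0 (steps , bounds) = rounded-steps , rounded-bounds
      where
      rounded : ℚ → ℚ
      rounded x = ℕ→ℚ (count θ x n)
      rounded-steps : ∀ j → suc j ℕ.< d → UnitStep (at false L (suc j)) (at 0ℚ (natPt (roundAt θ q)) j)
                                                                         (at 0ℚ (natPt (roundAt θ q)) (suc j))
      rounded-steps j j+1<d =
        subst₂ (UnitStep (at false L (suc j)))
               (sym (at-map-in rounded 0ℚ 0ℚ q j (ℕₚ.<-trans (ℕₚ.n<1+n j) j+1<d)))
               (sym (at-map-in rounded 0ℚ 0ℚ q (suc j) j+1<d))
               (count-unitStep (at false L (suc j)) θ n (at 0ℚ q j) (at 0ℚ q (suc j)) (steps j j+1<d))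
      rounded-bounds : ∀ (j : Fin d) → 0ℚ ≤ rounded (q j) × rounded (q j) ≤ bound (toℕ j)
      rounded-bounds j =
        ℕ→ℚ-nonneg (count θ (q j) n) ,
        subst (rounded (q j) ≤_) (sym (bound-ℕ j))
          (ℕ→ℚ-mono-≤ (count-bound θ (q j) (hU (suc (toℕ j)) ℕ.∸ hL (suc (toℕ j))) n θ≥0
                                    (subst (q j ≤_) (bound-ℕ j) (proj₂ (bounds j)))))

    -- Coordinates of Q_M are at most n, so rounding with K = n thresholds
    -- loses nothing.
    q≤n : ∀ q → InQ q → ∀ j → q j ≤ ℕ→ℚ n
    q≤n q (_ , bounds) j = ℚₚ.≤-trans (subst (q j ≤_) (bound-ℕ j) (proj₂ (bounds j)))
      (ℕ→ℚ-mono-≤ (ℕₚ.≤-trans (ℕₚ.m∸n≤m (hU (suc (toℕ j))) (hL (suc (toℕ j))))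
                              (ℕₚ.≤-trans (height-≤ U (suc (toℕ j))) (suc-toℕ≤n j))))

    fractions : Pt d → List ℚ
    fractions q = cartesianProductWith (λ j k → clamp01 (q j - ℕ→ℚ k)) (allFin d) (upTo n)

    thresholds : Pt d → List ℚ
    thresholds q = 0ℚ ∷ sort (fractions q)

    fractions-bounded : ∀ q → All (λ s → 0ℚ ≤ s × s ≤ 1ℚ) (fractions q)
    fractions-bounded q = All.tabulate λ s∈ →
      let (j , k , _ , _ , s≡) = ∈-cartesianProductWith⁻ (λ j k → clamp01 (q j - ℕ→ℚ k)) (allFin d) (upTo n) s∈
      in subst (λ s → 0ℚ ≤ s × s ≤ 1ℚ) (sym s≡) (clamp01-bounds (q j - ℕ→ℚ k))

    thresholds-bounded : ∀ q → All (λ s → 0ℚ ≤ s × s ≤ 1ℚ) (thresholds q)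
    thresholds-bounded q = (ℚₚ.≤-refl , 0≤1) ∷ All-resp-↭ (↭-sym (sort-↭ (fractions q))) (fractions-bounded q)

    thresholds-sorted : ∀ q → AllPairs _≤_ (thresholds q)
    thresholds-sorted q = All.map proj₁ (All.tail (thresholds-bounded q))
                          ∷ Sorted⇒AllPairs (DecTotalOrder.totalOrder ℚₚ.≤-decTotalOrder) (sort-↗ (fractions q))

    thresholds-complete : ∀ q j k → k ℕ.< n → clamp01 (q j - ℕ→ℚ k) ∈ thresholds q
    thresholds-complete q j k k<n = there (Any-resp-↭ (↭-sym (sort-↭ (fractions q)))
      (∈-cartesianProductWith⁺ (λ j k → clamp01 (q j - ℕ→ℚ k)) (∈-allFin j) (∈-upTo⁺ k<n)))

    decompose : ∀ q → InQ q → InConvHull IntegerPt q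
    decompose q q∈Q = map (map₂ rounding) stairs , weighted , total , q≐
      where
      stairs = staircase (thresholds q)
      rounding : ℚ → Pt d
      rounding θ = natPt (roundAt θ q)
      weighted : All (λ wp → 0ℚ ≤ proj₁ wp × IntegerPt (proj₂ wp)) (map (map₂ rounding) stairs)
      weighted = Allₚ.map⁺ (All.map (λ (w≥0 , θ≥0) → w≥0 , (roundAt _ q , roundAt-in-Q _ q θ≥0 q∈Q , λ _ → refl))
        (All.zip (staircase-weights 0ℚ _ (thresholds-sorted q) (All.map proj₂ (thresholds-bounded q)) ,
                  staircase-points (0ℚ ≤_) (thresholds q) (All.map proj₁ (thresholds-bounded q)))))
      total : weightSum (map (map₂ rounding) stairs) ≡ 1ℚ
      total = trans (weightSum-map₂ rounding stairs)
                    (trans (staircase-total 0ℚ (sort (fractions q))) (ℚₚ.+-identityʳ 1ℚ))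
      q≐ : q ≐ combo (map (map₂ rounding) stairs)
      q≐ j = begin
        q j                                         ≡⟨ sym (ℚₚ.p≤q⇒p⊓q≡p (q≤n q q∈Q j)) ⟩
        q j ⊓ ℕ→ℚ n                                 ≡⟨ sym (averageCount-staircase (sort (fractions q)) (q j) n
                                                          (proj₁ (proj₂ q∈Q j)) (thresholds-sorted q)
                                                          (thresholds-bounded q) (thresholds-complete q j)) ⟩
        wsum stairs (λ θ → rounding θ j)            ≡⟨ sym (wsum-map₂ rounding stairs (λ p → p j)) ⟩
        wsum (map (map₂ rounding) stairs) (λ p → p j) ≡⟨ sym (combo-wsum (map (map₂ rounding) stairs) j) ⟩
        combo (map (map₂ rounding) stairs) j        ∎
        where open ≡-Reasoning

    g-into-P-M : ∀ q → InQ q → P-M r m U L (g q)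
    g-into-P-M q q∈Q = hull-image g affine-g vertex q (decompose q q∈Q)
      where
      vertex : ∀ p → IntegerPt p → Vertex (g p)
      vertex p (v , v∈Q , p≐) =
        let (P , basis , g≐) = integer-point v v∈Q in P , basis , λ i → trans (g-cong p≐ i) (g≐ i)

    f-bijection : BijectsOnto f (P-M r m U L) (Q-M r m U L)
    f-bijection =
      (λ x x∈P → InQ⇒Q-M (apply f x) (f-into-Q x x∈P)) ,
      f-injective ,
      (λ q q∈Q → g q , g-into-P-M q (Q-M⇒InQ q q∈Q) , f∘g q)

    -- Q_M is distributive: its constraints are unit steps and interval
    -- bounds, both preserved by componentwise max and min.

    InQ-pointwise : (op : ℚ → ℚ → ℚ) →
      (∀ σ a b a' b' → UnitStep σ a b → UnitStep σ a' b' → UnitStep σ (op a a') (op b b')) →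
      (∀ {u v c} → 0ℚ ≤ u → u ≤ c → 0ℚ ≤ v → v ≤ c → 0ℚ ≤ op u v × op u v ≤ c) →
      ∀ x y → InQ x → InQ y → InQ (λ i → op (x i) (y i))
    InQ-pointwise op op-step op-bound x y (steps , bounds) (steps' , bounds') =
      (λ j j+1<d → subst₂ (UnitStep (at false L (suc j)))
                     (sym (at-map₂ op 0ℚ x y j (ℕₚ.<-trans (ℕₚ.n<1+n j) j+1<d)))
                     (sym (at-map₂ op 0ℚ x y (suc j) j+1<d))
                     (op-step (at false L (suc j)) (at 0ℚ x j) (at 0ℚ x (suc j)) (at 0ℚ y j) (at 0ℚ y (suc j))
                              (steps j j+1<d) (steps' j j+1<d))) ,
      (λ j → op-bound (proj₁ (bounds j)) (proj₂ (bounds j)) (proj₁ (bounds' j)) (proj₂ (bounds' j)))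

    InQ-⊔ : ∀ x y → InQ x → InQ y → InQ (λ i → x i ⊔ y i)
    InQ-⊔ = InQ-pointwise _⊔_ unitStep-⊔
      (λ {u} {v} 0≤u u≤c _ v≤c → ℚₚ.≤-trans 0≤u (ℚₚ.p≤p⊔q u v) , ℚₚ.⊔-lub u≤c v≤c)

    InQ-⊓ : ∀ x y → InQ x → InQ y → InQ (λ i → x i ⊓ y i)
    InQ-⊓ = InQ-pointwise _⊓_ unitStep-⊓
      (λ {u} {v} 0≤u u≤c 0≤v _ → ℚₚ.⊓-glb 0≤u 0≤v , ℚₚ.≤-trans (ℚₚ.p⊓q≤p u v) u≤c)

    distributive : Distributive (Q-M r m U L)
    distributive x y x∈Q y∈Q =
      InQ⇒Q-M _ (InQ-⊔ x y (Q-M⇒InQ x x∈Q) (Q-M⇒InQ y y∈Q)) ,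
      InQ⇒Q-M _ (InQ-⊓ x y (Q-M⇒InQ x x∈Q) (Q-M⇒InQ y y∈Q))

    -- With H = 9 + 4n, M = 2H and ε = 1/M, the point
    --   c_k = (H·h_U + 4k - H·h_L - 4·h_U - 4·h_L)·ε     (heights at k + 1)
    -- is at distance ≥ ε from the bounds, and its signed steps are 4ε or
    -- 1/2; so the box of radius ε around c lies in Q_M.

    module FullDimension (L<U : MeetOnlyAtEnds U L) where

      H M : ℕ
      H = 9 ℕ.+ 4 ℕ.* n
      M = H ℕ.+ H

      Mℚ ε : ℚ
      Mℚ = mkℚ (ℤ.+ M) 0 (coprime-1 M)
      ε  = ℚ.1/ Mℚ

      Mε≡1 : ℕ→ℚ M * ε ≡ 1ℚ
      Mε≡1 = trans (cong (_* ε) (ℤ→ℚ≡mkℚ (ℤ.+ M))) (ℚₚ.*-inverseʳ Mℚ)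

      ε>0 : 0ℚ < ε
      ε>0 = ℚₚ.positive⁻¹ ε {{ℚₚ.1/pos⇒pos Mℚ}}

      ε-scale : ∀ {a b} → a ≤ b → a * ε ≤ b * ε
      ε-scale = ℚₚ.*-monoʳ-≤-nonNeg ε {{ℚ.nonNegative (ℚₚ.<⇒≤ ε>0)}}

      inner-multiple : ∀ a → 2 ℕ.≤ a → a ℕ.+ 2 ℕ.≤ M → ε + ε ≤ ℕ→ℚ a * ε × ℕ→ℚ a * ε ≤ 1ℚ - (ε + ε)
      inner-multiple a 2≤a a+2≤M =
        ℚₚ.≤-trans (ℚₚ.≤-reflexive (double ε)) (ε-scale (ℕ→ℚ-mono-≤ {2} {a} 2≤a)) ,
        ℚₚ.≤-trans (ℚₚ.≤-reflexive (shift (ℕ→ℚ a) ε))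
          (ℚₚ.+-monoˡ-≤ (- (ε + ε)) (ℚₚ.≤-trans (ℚₚ.≤-reflexive (cong (_* ε) (sym (ℕ→ℚ-+ a 2))))
            (ℚₚ.≤-trans (ε-scale (ℕ→ℚ-mono-≤ {a ℕ.+ 2} {M} a+2≤M)) (ℚₚ.≤-reflexive Mε≡1))))
        where
        double : ∀ w → w + w ≡ ℕ→ℚ 2 * w
        double = solve-∀ ℚ-ring
        shift : ∀ a w → a * w ≡ (a + ℕ→ℚ 2) * w - (w + w)
        shift = solve-∀ ℚ-ring

      num⁺ num⁻ : ℕ → ℕ
      num⁺ k = H ℕ.* hU (suc k) ℕ.+ 4 ℕ.* k
      num⁻ k = H ℕ.* hL (suc k) ℕ.+ 4 ℕ.* hU (suc k) ℕ.+ 4 ℕ.* hL (suc k)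

      centreNum : ℕ → ℚ
      centreNum k = ℕ→ℚ (num⁺ k) - ℕ→ℚ (num⁻ k)

      centre : Pt d
      centre j = centreNum (toℕ j) * ε

      L<U-inside : ∀ k → k ℕ.< d → hL (suc k) ℕ.< hU (suc k)
      L<U-inside k k<d = L<U (suc k) (s≤s z≤n) (inside n k k<d)
        where
        inside : ∀ n k → k ℕ.< n ℕ.∸ 1 → suc k ℕ.< n
        inside (suc n) k k<n = s≤s k<n

      k≤n : ∀ k → k ℕ.< d → k ℕ.≤ n
      k≤n k k<d = ℕₚ.≤-trans (ℕₚ.<⇒≤ k<d) d≤n

      -- c_k ≥ ε  (in ℕ, before scaling by ε).
      num-lower : ∀ k → k ℕ.< d → num⁻ k ℕ.+ 1 ℕ.≤ num⁺ k
      num-lower k k<d = begin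
        H ℕ.* a ℕ.+ 4 ℕ.* b ℕ.+ 4 ℕ.* a ℕ.+ 1
          ≤⟨ ℕₚ.+-monoˡ-≤ 1 (ℕₚ.+-mono-≤ (ℕₚ.+-monoʳ-≤ (H ℕ.* a) (ℕₚ.*-monoʳ-≤ 4 (height-≤ U (suc k))))
                                         (ℕₚ.*-monoʳ-≤ 4 (height-≤ L (suc k)))) ⟩
        H ℕ.* a ℕ.+ 4 ℕ.* suc k ℕ.+ 4 ℕ.* suc k ℕ.+ 1
          ≡⟨ regroup₁ H a k ⟩
        H ℕ.* a ℕ.+ (4 ℕ.* k ℕ.+ 4 ℕ.* k) ℕ.+ 9
          ≤⟨ ℕₚ.+-monoˡ-≤ 9 (ℕₚ.+-monoʳ-≤ (H ℕ.* a) (ℕₚ.+-monoˡ-≤ (4 ℕ.* k) (ℕₚ.*-monoʳ-≤ 4 (k≤n k k<d)))) ⟩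
        H ℕ.* a ℕ.+ (4 ℕ.* n ℕ.+ 4 ℕ.* k) ℕ.+ 9
          ≡⟨ regroup₂ n a k ⟩
        H ℕ.* suc a ℕ.+ 4 ℕ.* k
          ≤⟨ ℕₚ.+-monoˡ-≤ (4 ℕ.* k) (ℕₚ.*-monoʳ-≤ H (L<U-inside k k<d)) ⟩
        H ℕ.* b ℕ.+ 4 ℕ.* k ∎
        where
        open ℕₚ.≤-Reasoning
        a = hL (suc k)
        b = hU (suc k)
        regroup₁ : ∀ H a k → H ℕ.* a ℕ.+ 4 ℕ.* suc k ℕ.+ 4 ℕ.* suc k ℕ.+ 1
                           ≡ H ℕ.* a ℕ.+ (4 ℕ.* k ℕ.+ 4 ℕ.* k) ℕ.+ 9
        regroup₁ = ℕ-Solver.solve-∀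
        regroup₂ : ∀ n a k → (9 ℕ.+ 4 ℕ.* n) ℕ.* a ℕ.+ (4 ℕ.* n ℕ.+ 4 ℕ.* k) ℕ.+ 9
                           ≡ (9 ℕ.+ 4 ℕ.* n) ℕ.* suc a ℕ.+ 4 ℕ.* k
        regroup₂ = ℕ-Solver.solve-∀

      -- c_k + ε ≤ h_U - h_L  (in ℕ, after multiplying by M).
      num-upper : ∀ k → k ℕ.< d → num⁺ k ℕ.+ 1 ℕ.+ M ℕ.* hL (suc k) ℕ.≤ M ℕ.* hU (suc k) ℕ.+ num⁻ k
      num-upper k k<d = begin
        H ℕ.* b ℕ.+ 4 ℕ.* k ℕ.+ 1 ℕ.+ M ℕ.* a
          ≡⟨ regroup₁ H a b k ⟩
        H ℕ.* b ℕ.+ H ℕ.* a ℕ.+ (H ℕ.* a ℕ.+ (4 ℕ.* k ℕ.+ 1))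
          ≤⟨ ℕₚ.+-monoʳ-≤ (H ℕ.* b ℕ.+ H ℕ.* a) (ℕₚ.+-monoʳ-≤ (H ℕ.* a) 4k+1≤H) ⟩
        H ℕ.* b ℕ.+ H ℕ.* a ℕ.+ (H ℕ.* a ℕ.+ H)
          ≡⟨ regroup₂ H a b ⟩
        H ℕ.* b ℕ.+ H ℕ.* a ℕ.+ H ℕ.* suc a
          ≤⟨ ℕₚ.+-monoʳ-≤ (H ℕ.* b ℕ.+ H ℕ.* a) (ℕₚ.*-monoʳ-≤ H (L<U-inside k k<d)) ⟩
        H ℕ.* b ℕ.+ H ℕ.* a ℕ.+ H ℕ.* b
          ≤⟨ ℕₚ.m≤m+n (H ℕ.* b ℕ.+ H ℕ.* a ℕ.+ H ℕ.* b) (4 ℕ.* b ℕ.+ 4 ℕ.* a) ⟩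
        H ℕ.* b ℕ.+ H ℕ.* a ℕ.+ H ℕ.* b ℕ.+ (4 ℕ.* b ℕ.+ 4 ℕ.* a)
          ≡⟨ regroup₃ H a b ⟩
        M ℕ.* b ℕ.+ (H ℕ.* a ℕ.+ 4 ℕ.* b ℕ.+ 4 ℕ.* a) ∎
        where
        open ℕₚ.≤-Reasoning
        a = hL (suc k)
        b = hU (suc k)
        4k+1≤H : 4 ℕ.* k ℕ.+ 1 ℕ.≤ H
        4k+1≤H = ℕₚ.≤-trans (ℕₚ.+-monoˡ-≤ 1 (ℕₚ.*-monoʳ-≤ 4 (k≤n k k<d)))
                   (ℕₚ.≤-trans (ℕₚ.+-monoʳ-≤ (4 ℕ.* n) (s≤s z≤n)) (ℕₚ.≤-reflexive (ℕₚ.+-comm (4 ℕ.* n) 9)))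
        regroup₁ : ∀ H a b k → H ℕ.* b ℕ.+ 4 ℕ.* k ℕ.+ 1 ℕ.+ (H ℕ.+ H) ℕ.* a
                             ≡ H ℕ.* b ℕ.+ H ℕ.* a ℕ.+ (H ℕ.* a ℕ.+ (4 ℕ.* k ℕ.+ 1))
        regroup₁ = ℕ-Solver.solve-∀
        regroup₂ : ∀ H a b → H ℕ.* b ℕ.+ H ℕ.* a ℕ.+ (H ℕ.* a ℕ.+ H) ≡ H ℕ.* b ℕ.+ H ℕ.* a ℕ.+ H ℕ.* suc a
        regroup₂ = ℕ-Solver.solve-∀
        regroup₃ : ∀ H a b → H ℕ.* b ℕ.+ H ℕ.* a ℕ.+ H ℕ.* b ℕ.+ (4 ℕ.* b ℕ.+ 4 ℕ.* a)
                           ≡ (H ℕ.+ H) ℕ.* b ℕ.+ (H ℕ.* a ℕ.+ 4 ℕ.* b ℕ.+ 4 ℕ.* a)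
        regroup₃ = ℕ-Solver.solve-∀

      centre-lower : ∀ k → k ℕ.< d → 0ℚ ≤ centreNum k * ε - ε
      centre-lower k k<d = ℚₚ.≤-trans (ℚₚ.≤-reflexive (sym (ℚₚ.*-zeroˡ ε)))
        (ℚₚ.≤-trans (ε-scale (≤⇒0≤- num⁻+1≤num⁺)) (ℚₚ.≤-reflexive (regroup (ℕ→ℚ (num⁺ k)) (ℕ→ℚ (num⁻ k)) ε)))
        where
        num⁻+1≤num⁺ : ℕ→ℚ (num⁻ k) + 1ℚ ≤ ℕ→ℚ (num⁺ k)
        num⁻+1≤num⁺ = subst (_≤ ℕ→ℚ (num⁺ k)) (ℕ→ℚ-+ (num⁻ k) 1)
                            (ℕ→ℚ-mono-≤ {num⁻ k ℕ.+ 1} {num⁺ k} (num-lower k k<d))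
        regroup : ∀ p q w → (p - (q + 1ℚ)) * w ≡ (p - q) * w - w
        regroup = solve-∀ ℚ-ring

      centre-upper : ∀ k → k ℕ.< d → centreNum k * ε + ε ≤ bound k
      centre-upper k k<d = ℚₚ.≤-trans (ℚₚ.≤-reflexive (regroup₁ (centreNum k) ε))
        (ℚₚ.≤-trans (ε-scale numerator≤)
          (ℚₚ.≤-reflexive (trans (regroup₄ (ℕ→ℚ M) (b - a) ε)
                                 (trans (cong (_* (b - a)) Mε≡1) (ℚₚ.*-identityˡ (b - a))))))
        where
        regroup₁ : ∀ c w → c * w + w ≡ (c + 1ℚ) * w
        regroup₁ = solve-∀ ℚ-ring
        regroup₂ : ∀ p q M a → p - q + 1ℚ ≡ p + 1ℚ + M * a - (M * a + q)
        regroup₂ = solve-∀ ℚ-ring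
        regroup₃ : ∀ q M a b → M * b + q - (M * a + q) ≡ M * (b - a)
        regroup₃ = solve-∀ ℚ-ring
        regroup₄ : ∀ M x w → M * x * w ≡ (M * w) * x
        regroup₄ = solve-∀ ℚ-ring
        a = ℕ→ℚ (hL (suc k))
        b = ℕ→ℚ (hU (suc k))
        p = ℕ→ℚ (num⁺ k)
        q = ℕ→ℚ (num⁻ k)
        upperℚ : p + 1ℚ + ℕ→ℚ M * a ≤ ℕ→ℚ M * b + q
        upperℚ = subst₂ _≤_
          (trans (ℕ→ℚ-+ (num⁺ k ℕ.+ 1) (M ℕ.* hL (suc k))) (cong₂ _+_ (ℕ→ℚ-+ (num⁺ k) 1) (ℕ→ℚ-* M (hL (suc k)))))
          (trans (ℕ→ℚ-+ (M ℕ.* hU (suc k)) (num⁻ k)) (cong (_+ q) (ℕ→ℚ-* M (hU (suc k)))))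
          (ℕ→ℚ-mono-≤ {num⁺ k ℕ.+ 1 ℕ.+ M ℕ.* hL (suc k)} {M ℕ.* hU (suc k) ℕ.+ num⁻ k} (num-upper k k<d))
        numerator≤ : centreNum k + 1ℚ ≤ ℕ→ℚ M * (b - a)
        numerator≤ = ℚₚ.≤-trans (ℚₚ.≤-reflexive (regroup₂ p q (ℕ→ℚ M) a))
          (ℚₚ.≤-trans (ℚₚ.+-monoˡ-≤ (- (ℕ→ℚ M * a + q)) upperℚ)
                      (ℚₚ.≤-reflexive (regroup₃ q (ℕ→ℚ M) a b)))

      Hℚ 4ℚ : ℚ
      Hℚ = ℕ→ℚ H
      4ℚ = ℕ→ℚ 4

      shape : ℚ → ℚ → ℚ → ℚ
      shape u l k = Hℚ * u + 4ℚ * k - (Hℚ * l + 4ℚ * u + 4ℚ * l)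

      centreNum≡ : ∀ k → centreNum k ≡ shape (ℕ→ℚ (hU (suc k))) (ℕ→ℚ (hL (suc k))) (ℕ→ℚ k)
      centreNum≡ k = cong₂ _-_
        (trans (ℕ→ℚ-+ (H ℕ.* hU (suc k)) (4 ℕ.* k)) (cong₂ _+_ (ℕ→ℚ-* H (hU (suc k))) (ℕ→ℚ-* 4 k)))
        (trans (ℕ→ℚ-+ (H ℕ.* hL (suc k) ℕ.+ 4 ℕ.* hU (suc k)) (4 ℕ.* hL (suc k)))
          (cong₂ _+_ (trans (ℕ→ℚ-+ (H ℕ.* hL (suc k)) (4 ℕ.* hU (suc k)))
                            (cong₂ _+_ (ℕ→ℚ-* H (hL (suc k))) (ℕ→ℚ-* 4 (hU (suc k)))))
                     (ℕ→ℚ-* 4 (hL (suc k)))))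

      centre-step : ∀ k → centreNum (suc k) - centreNum k
                          ≡ Hℚ * (bit (at false U (suc k)) - bit (at false L (suc k)))
                            + 4ℚ * (1ℚ - bit (at false U (suc k)) - bit (at false L (suc k)))
      centre-step k = begin
        centreNum (suc k) - centreNum k
          ≡⟨ cong₂ _-_ (centreNum≡ (suc k)) (centreNum≡ k) ⟩
        shape (ℕ→ℚ (hU (suc (suc k)))) (ℕ→ℚ (hL (suc (suc k)))) (ℕ→ℚ (suc k)) - shape u₀ l₀ k₀
          ≡⟨ cong (_- shape u₀ l₀ k₀) (cong₂ (λ x y → shape x y (ℕ→ℚ (suc k)))
                                                (heightℚ-suc U (suc k)) (heightℚ-suc L (suc k))) ⟩
        shape (u₀ + u) (l₀ + l) (ℕ→ℚ (suc k)) - shape u₀ l₀ k₀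
          ≡⟨ cong (λ z → shape (u₀ + u) (l₀ + l) z - shape u₀ l₀ k₀) (ℕ→ℚ-suc k) ⟩
        shape (u₀ + u) (l₀ + l) (k₀ + 1ℚ) - shape u₀ l₀ k₀
          ≡⟨ difference Hℚ 4ℚ u₀ l₀ k₀ u l ⟩
        Hℚ * (u - l) + 4ℚ * (1ℚ - u - l) ∎
        where
        open ≡-Reasoning
        u₀ = ℕ→ℚ (hU (suc k))
        l₀ = ℕ→ℚ (hL (suc k))
        k₀ = ℕ→ℚ k
        u = bit (at false U (suc k))
        l = bit (at false L (suc k))
        difference : ∀ H F u₀ l₀ k₀ u l →
          H * (u₀ + u) + F * (k₀ + 1ℚ) - (H * (l₀ + l) + F * (u₀ + u) + F * (l₀ + l))
            - (H * u₀ + F * k₀ - (H * l₀ + F * u₀ + F * l₀))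
          ≡ H * (u - l) + F * (1ℚ - u - l)
        difference = solve-∀ ℚ-ring

      2≤4 : 2 ℕ.≤ 4
      2≤4 = s≤s (s≤s z≤n)

      2≤H : 2 ℕ.≤ H
      2≤H = ℕₚ.≤-trans (s≤s (s≤s z≤n)) (ℕₚ.m≤m+n 9 (4 ℕ.* n))

      4+2≤M : 4 ℕ.+ 2 ℕ.≤ M
      4+2≤M = ℕₚ.≤-trans (s≤s (s≤s (s≤s (s≤s (s≤s (s≤s z≤n))))))
                (ℕₚ.≤-trans (ℕₚ.m≤m+n 9 (4 ℕ.* n)) (ℕₚ.m≤m+n H H))

      -- Signed by the step of L, every step of the centre is 4 or H.
      step-value : ∀ ub lb → Σ ℕ λ a → 2 ℕ.≤ a × a ℕ.+ 2 ℕ.≤ M ×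
                   signed lb (Hℚ * (bit ub - bit lb) + 4ℚ * (1ℚ - bit ub - bit lb)) ≡ ℕ→ℚ a
      step-value false false = 4 , 2≤4 , 4+2≤M , ff Hℚ 4ℚ
        where
        ff : ∀ H F → H * (0ℚ - 0ℚ) + F * (1ℚ - 0ℚ - 0ℚ) ≡ F
        ff = solve-∀ ℚ-ring
      step-value true  false = H , 2≤H , ℕₚ.+-monoʳ-≤ H 2≤H , tf Hℚ 4ℚ
        where
        tf : ∀ H F → H * (1ℚ - 0ℚ) + F * (1ℚ - 1ℚ - 0ℚ) ≡ H
        tf = solve-∀ ℚ-ring
      step-value true  true  = 4 , 2≤4 , 4+2≤M , tt Hℚ 4ℚ
        where
        tt : ∀ H F → - (H * (1ℚ - 1ℚ) + F * (1ℚ - 1ℚ - 1ℚ)) ≡ F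
        tt = solve-∀ ℚ-ring
      step-value false true  = H , 2≤H , ℕₚ.+-monoʳ-≤ H 2≤H , ft Hℚ 4ℚ
        where
        ft : ∀ H F → - (H * (0ℚ - 1ℚ) + F * (1ℚ - 0ℚ - 1ℚ)) ≡ H
        ft = solve-∀ ℚ-ring

      signed-scale : ∀ σ a w → signed σ (a * w) ≡ signed σ a * w
      signed-scale false a w = refl
      signed-scale true  a w = neg-scale a w
        where
        neg-scale : ∀ a w → - (a * w) ≡ - a * w
        neg-scale = solve-∀ ℚ-ring

      centre-gap : ∀ k → ε + ε ≤ signed (at false L (suc k)) (centreNum (suc k) * ε - centreNum k * ε)
                       × signed (at false L (suc k)) (centreNum (suc k) * ε - centreNum k * ε) ≤ 1ℚ - (ε + ε)
      centre-gap k =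
        let (a , 2≤a , a+2≤M , value) = step-value (at false U (suc k)) (at false L (suc k))
        in subst (λ v → ε + ε ≤ v × v ≤ 1ℚ - (ε + ε)) (sym (gap≡ a value)) (inner-multiple a 2≤a a+2≤M)
        where
        σ = at false L (suc k)
        factor : ∀ a b w → a * w - b * w ≡ (a - b) * w
        factor = solve-∀ ℚ-ring
        gap≡ : ∀ a → signed σ (Hℚ * (bit (at false U (suc k)) - bit σ) + 4ℚ * (1ℚ - bit (at false U (suc k)) - bit σ)) ≡ ℕ→ℚ a →
               signed σ (centreNum (suc k) * ε - centreNum k * ε) ≡ ℕ→ℚ a * ε
        gap≡ a value = trans (cong (signed σ) (factor (centreNum (suc k)) (centreNum k) ε))
          (trans (signed-scale σ _ ε) (cong (_* ε) (trans (cong (signed σ) (centre-step k)) value)))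

      near-step : ∀ σ x x' c c' → c - ε ≤ x → x ≤ c + ε → c' - ε ≤ x' → x' ≤ c' + ε →
                  ε + ε ≤ signed σ (c' - c) → signed σ (c' - c) ≤ 1ℚ - (ε + ε) → UnitStep σ x x'
      near-step false x x' c c' x≥ x≤ x'≥ x'≤ gap≥ gap≤ = unitStep-near x x' c c' ε x≥ x≤ x'≥ x'≤ gap≥ gap≤
      near-step true  x x' c c' x≥ x≤ x'≥ x'≤ gap≥ gap≤ = unitStep-unflip x x'
        (unitStep-near x' x c' c ε x'≥ x'≤ x≥ x≤ (subst (ε + ε ≤_) (flip c c') gap≥)
                                                  (subst (_≤ 1ℚ - (ε + ε)) (flip c c') gap≤))
        where
        flip : ∀ c c' → - (c' - c) ≡ c - c'
        flip = solve-∀ ℚ-ring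

      box-in-Q : ∀ x → (∀ i → ∣ x i - centre i ∣ ≤ ε) → InQ x
      box-in-Q x near = steps , bounds
        where
        near-at : ∀ k → k ℕ.< d → centreNum k * ε - ε ≤ at 0ℚ x k × at 0ℚ x k ≤ centreNum k * ε + ε
        near-at k k<d = subst₂ (λ c v → c * ε - ε ≤ v × v ≤ c * ε + ε)
          (cong centreNum (Finₚ.toℕ-fromℕ< k<d)) (sym (at-fromℕ< 0ℚ x k k<d))
          (∣-∣≤⇒box (x (fromℕ< k<d)) (centre (fromℕ< k<d)) ε (near (fromℕ< k<d)))
        steps : ∀ j → suc j ℕ.< d → UnitStep (at false L (suc j)) (at 0ℚ x j) (at 0ℚ x (suc j))
        steps j j+1<d =
          let (x≥ , x≤) = near-at j (ℕₚ.<-trans (ℕₚ.n<1+n j) j+1<d)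
              (x'≥ , x'≤) = near-at (suc j) j+1<d
              (gap≥ , gap≤) = centre-gap j
          in near-step (at false L (suc j)) _ _ (centreNum j * ε) (centreNum (suc j) * ε) x≥ x≤ x'≥ x'≤ gap≥ gap≤
        bounds : ∀ (j : Fin d) → 0ℚ ≤ x j × x j ≤ bound (toℕ j)
        bounds j = let (x≥ , x≤) = ∣-∣≤⇒box (x j) (centre j) ε (near j) in
          ℚₚ.≤-trans (centre-lower (toℕ j) (Finₚ.toℕ<n j)) x≥ ,
          ℚₚ.≤-trans x≤ (centre-upper (toℕ j) (Finₚ.toℕ<n j))

      full-dimensional : FullDimensional (Q-M r m U L)
      full-dimensional = centre , ε , ε>0 , λ x near → InQ⇒Q-M x (box-in-Q x near)

    -- Q_M is an integer polytope: the convex hull of its integer points,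
    -- which lie in the box {0, ..., n}^d.

    InQ? : ∀ q → Dec (InQ q)
    InQ? q =
      map′ (λ all j j+1<d → all j (ℕₚ.<-trans (ℕₚ.n<1+n j) j+1<d) j+1<d) (λ all j _ j+1<d → all j j+1<d)
           (bounded? (λ j → suc j ℕ.< d → UnitStep (at false L (suc j)) (at 0ℚ q j) (at 0ℚ q (suc j)))
                     (λ j → (suc j ℕ.<? d) →-dec ((0ℚ ℚₚ.≤? stepOf j) ×-dec (stepOf j ℚₚ.≤? 1ℚ))) d)
      ×-dec Finₚ.all? (λ j → (0ℚ ℚₚ.≤? q j) ×-dec (q j ℚₚ.≤? bound (toℕ j)))
      where
      stepOf : ℕ → ℚ
      stepOf j = signed (at false L (suc j)) (at 0ℚ q (suc j) - at 0ℚ q j)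

    toℤ : (Fin d → ℕ) → (Fin d → ℤ)
    toℤ v j = ℤ.+ (v j)

    integerVertices : List (Fin d → ℤ)
    integerVertices = map toℤ (filter (λ v → InQ? (natPt v)) (natBox d n))

    IntegerVertex : Pt d → Set
    IntegerVertex p = Σ (Fin d → ℤ) λ z → z ∈ integerVertices × p ≐ (λ i → ℤ→ℚ (z i))

    integerVertex-in-Q : ∀ p → IntegerVertex p → InQ p
    integerVertex-in-Q p (z , z∈ , p≐) =
      let (v , v∈ , z≡) = ∈-map⁻ toℤ z∈
          (_ , v∈Q) = ∈-filter⁻ (λ v → InQ? (natPt v)) {xs = natBox d n} v∈
      in InQ-resp (λ i → sym (trans (p≐ i) (cong (λ z → ℤ→ℚ (z i)) z≡))) v∈Q

    integerPt-vertex : ∀ p → IntegerPt p → IntegerVertex p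
    integerPt-vertex p (v , v∈Q , p≐) =
      let (u , u∈ , u≡v) = natBox-complete d n v (λ i → ℕ→ℚ-cancel-≤ {v i} {n} (q≤n (natPt v) v∈Q i))
          u≐v : natPt u ≐ natPt v
          u≐v i = cong ℕ→ℚ (u≡v i)
      in toℤ u ,
         ∈-map⁺ toℤ (∈-filter⁺ (λ v → InQ? (natPt v)) u∈ (InQ-resp (λ i → sym (u≐v i)) v∈Q)) ,
         λ i → trans (p≐ i) (sym (u≐v i))

    -- Q_M is the hull of its integer points, as it is convex.
    integer-polytope : IntegerPolytope (Q-M r m U L)
    integer-polytope = integerVertices , λ x →
      (λ x∈Q → hull-mono integerPt-vertex x (decompose x (Q-M⇒InQ x x∈Q))) ,
      (λ hull → InQ⇒Q-M x (InQ-hull x (hull-mono integerVertex-in-Q x hull)))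

    -- The lattice points of the dilates correspond: on a dilate t·x the map
    -- f is given by integer arithmetic, and so is g on t·q.

    fℤ : ℕ → (Fin n → ℤ) → (Fin d → ℤ)
    fℤ t z j = Σ<ℤ (at (ℤ.+ 0) z) (suc (toℕ j)) ℤ.- ℤ.+ t ℤ.* ℤ.+ hL (suc (toℕ j))

    extℤ : (Fin d → ℤ) → ℕ → ℤ
    extℤ y zero    = ℤ.+ 0
    extℤ y (suc k) = at (ℤ.+ 0) y k

    gℤ : ℕ → (Fin d → ℤ) → (Fin n → ℤ)
    gℤ t y i = extℤ y (suc (toℕ i)) ℤ.- extℤ y (toℕ i) ℤ.+ ℤ.+ t ℤ.* ℤ.+ b2n (at false L (toℕ i))

    at-dilate : ∀ {k} t (z : Fin k → ℤ) (x : Pt k) → (∀ i → ℤ→ℚ (z i) ≡ ℕ→ℚ t * x i) →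
                ∀ j → ℤ→ℚ (at (ℤ.+ 0) z j) ≡ ℕ→ℚ t * at 0ℚ x j
    at-dilate t z x z≐ j =
      trans (sym (at-map ℤ→ℚ (ℤ.+ 0) z j))
            (trans (at-cong 0ℚ z≐ j) (at-map-default (ℕ→ℚ t *_) 0ℚ (ℚₚ.*-zeroʳ (ℕ→ℚ t)) x j))

    fℤ-dilate : ∀ t z x → (∀ i → ℤ→ℚ (z i) ≡ ℕ→ℚ t * x i) → ∀ j → ℤ→ℚ (fℤ t z j) ≡ ℕ→ℚ t * apply f x j
    fℤ-dilate t z x z≐ j = begin
      ℤ→ℚ (Σ<ℤ (at (ℤ.+ 0) z) c ℤ.- ℤ.+ t ℤ.* ℤ.+ hL c)
        ≡⟨ ℤ→ℚ-- (Σ<ℤ (at (ℤ.+ 0) z) c) (ℤ.+ t ℤ.* ℤ.+ hL c) ⟩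
      ℤ→ℚ (Σ<ℤ (at (ℤ.+ 0) z) c) - ℤ→ℚ (ℤ.+ t ℤ.* ℤ.+ hL c)
        ≡⟨ cong₂ _-_ (trans (ℤ→ℚ-Σ<ℤ (at (ℤ.+ 0) z) c) (Σ<-cong _ _ c (λ k _ → at-dilate t z x z≐ k)))
                     (ℤ→ℚ-* (ℤ.+ t) (ℤ.+ hL c)) ⟩
      Σ< (λ k → ℕ→ℚ t * at 0ℚ x k) c - ℕ→ℚ t * ℕ→ℚ (hL c)
        ≡⟨ cong (_- ℕ→ℚ t * ℕ→ℚ (hL c)) (Σ<-scale (ℕ→ℚ t) (at 0ℚ x) c) ⟩
      ℕ→ℚ t * Σ< (at 0ℚ x) c - ℕ→ℚ t * ℕ→ℚ (hL c)
        ≡⟨ factor (ℕ→ℚ t) (Σ< (at 0ℚ x) c) (ℕ→ℚ (hL c)) ⟩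
      ℕ→ℚ t * profile x c
        ≡⟨ cong (ℕ→ℚ t *_) (sym (apply-f x j)) ⟩
      ℕ→ℚ t * apply f x j ∎
      where
      open ≡-Reasoning
      c = suc (toℕ j)
      factor : ∀ t s h → t * s - t * h ≡ t * (s - h)
      factor = solve-∀ ℚ-ring

    gℤ-dilate : ∀ t y q → (∀ j → ℤ→ℚ (y j) ≡ ℕ→ℚ t * q j) → ∀ i → ℤ→ℚ (gℤ t y i) ≡ ℕ→ℚ t * g q i
    gℤ-dilate t y q y≐ i = begin
      ℤ→ℚ (extℤ y (suc k) ℤ.- extℤ y k ℤ.+ ℤ.+ t ℤ.* ℤ.+ b2n (at false L k))
        ≡⟨ trans (ℤ→ℚ-+ (extℤ y (suc k) ℤ.- extℤ y k) _)
                 (cong₂ _+_ (ℤ→ℚ-- (extℤ y (suc k)) (extℤ y k)) (ℤ→ℚ-* (ℤ.+ t) (ℤ.+ b2n (at false L k)))) ⟩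
      ℤ→ℚ (extℤ y (suc k)) - ℤ→ℚ (extℤ y k) + ℕ→ℚ t * ℕ→ℚ (b2n (at false L k))
        ≡⟨ combine (ext-dilate (suc k)) (ext-dilate k) (cong (ℕ→ℚ t *_) (sym (bit≡ (at false L k)))) ⟩
      ℕ→ℚ t * ext q (suc k) - ℕ→ℚ t * ext q k + ℕ→ℚ t * bit (at false L k)
        ≡⟨ factor (ℕ→ℚ t) (ext q (suc k)) (ext q k) (bit (at false L k)) ⟩
      ℕ→ℚ t * g q i ∎
      where
      open ≡-Reasoning
      k = toℕ i
      ext-dilate : ∀ k → ℤ→ℚ (extℤ y k) ≡ ℕ→ℚ t * ext q k
      ext-dilate zero    = sym (ℚₚ.*-zeroʳ (ℕ→ℚ t))
      ext-dilate (suc k) = at-dilate t y q y≐ k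
      combine : ∀ {a a' b b' c c'} → a ≡ a' → b ≡ b' → c ≡ c' → a - b + c ≡ a' - b' + c'
      combine refl refl refl = refl
      factor : ∀ t a b l → t * a - t * b + t * l ≡ t * (a - b + l)
      factor = solve-∀ ℚ-ring

    -- fℤ is injective on the lattice points of t·P_M: for t = 0 there is
    -- only the origin, otherwise cancel t and use injectivity of f.
    fℤ-injective : ∀ t z w → InDilate (P-M r m U L) t z → InDilate (P-M r m U L) t w →
                   (∀ j → fℤ t z j ≡ fℤ t w j) → ∀ i → z i ≡ w i
    fℤ-injective zero    z w (x , _ , z≐) (x' , _ , w≐) _ i =
      ℤ→ℚ-injective (trans (z≐ i) (trans (ℚₚ.*-zeroˡ (x i)) (sym (trans (w≐ i) (ℚₚ.*-zeroˡ (x' i))))))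
    fℤ-injective (suc t) z w (x , x∈P , z≐) (x' , x'∈P , w≐) fz≡fw i =
      ℤ→ℚ-injective (trans (z≐ i) (trans (cong (ℕ→ℚ (suc t) *_) (f-injective x x' x∈P x'∈P fx≐fx' i)) (sym (w≐ i))))
      where
      t>0 : 0ℚ < ℕ→ℚ (suc t)
      t>0 = ℚₚ.<-≤-trans (ℚₚ.positive⁻¹ 1ℚ) (ℕ→ℚ-mono-≤ {1} {suc t} (s≤s z≤n))
      cancel : ∀ {a b} → ℕ→ℚ (suc t) * a ≡ ℕ→ℚ (suc t) * b → a ≡ b
      cancel e = ℚₚ.≤-antisym (ℚₚ.*-cancelˡ-≤-pos (ℕ→ℚ (suc t)) {{ℚ.positive t>0}} (ℚₚ.≤-reflexive e))
                              (ℚₚ.*-cancelˡ-≤-pos (ℕ→ℚ (suc t)) {{ℚ.positive t>0}} (ℚₚ.≤-reflexive (sym e)))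
      fx≐fx' : apply f x ≐ apply f x'
      fx≐fx' j = cancel (trans (sym (fℤ-dilate (suc t) z x z≐ j))
                               (trans (cong ℤ→ℚ (fz≡fw j)) (fℤ-dilate (suc t) w x' w≐ j)))

    same-ehrhart : ∀ t → SameEhrhart (P-M r m U L) (Q-M r m U L) t
    same-ehrhart t = fℤ t , maps-into , fℤ-injective t , onto
      where
      maps-into : ∀ z → InDilate (P-M r m U L) t z → InDilate (Q-M r m U L) t (fℤ t z)
      maps-into z (x , x∈P , z≐) = apply f x , InQ⇒Q-M (apply f x) (f-into-Q x x∈P) , fℤ-dilate t z x z≐
      onto : ∀ y → InDilate (Q-M r m U L) t y →
             Σ (Fin n → ℤ) λ z → InDilate (P-M r m U L) t z × (∀ j → fℤ t z j ≡ y j)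
      onto y (q , q∈Q , y≐) =
        gℤ t y , (g q , g-into-P-M q (Q-M⇒InQ q q∈Q) , gℤ-dilate t y q y≐) ,
        λ j → ℤ→ℚ-injective (trans (fℤ-dilate t (gℤ t y) (g q) (gℤ-dilate t y q y≐) j)
                                   (trans (cong (ℕ→ℚ t *_) (f∘g q j)) (sym (y≐ j))))

open Proof using (module PathPolytope)
open import Data.Nat using (ℕ; _+_; _∸_)
open import Data.Product using (Σ; _×_; _,_)

theorem4p1 : (r m : ℕ) (U L : StepVec (r + m)) →
    IsPath r m U → IsPath r m L → NeverAbove L U → MeetOnlyAtEnds U L →
    (Σ (AffineMap (r + m) ((r + m) ∸ 1)) λ f →
        BijectsOnto f (P-M r m U L) (Q-M r m U L))
    × FullDimensional (Q-M r m U L)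
    × Distributive (Q-M r m U L)
    × IntegerPolytope (Q-M r m U L)
    × ((t : ℕ) → SameEhrhart (P-M r m U L) (Q-M r m U L) t)
theorem4p1 r m U L U-end L-end L≤U L<U =
  (f , f-bijection) , full-dimensional , distributive , integer-polytope , same-ehrhart
  where
  open PathPolytope r m U L U-end L-end L≤U
  open FullDimension L<U
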